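{- Let $\xi$ be a nonzero countable ordinal. (i) For every infinite disjoint collection $\mathcal{D}$ there exists a unique sequence $(\mathbf{s}_n)_{n\in\mathbb{N}}\subseteq\mathcal{B}^\xi$ with $\bigcup_{F\in\mathbf{s}_1}F<\bigcup_{F\in\mathbf{s}_2}F<\cdots$ and $\mathcal{D}=\bigcup_{n}\mathbf{s}_n$. (ii) For every nonempty finite disjoint collection $\mathbf{s}$ there exist unique $n\ge0$, $\mathbf{s}_1,\dots,\mathbf{s}_n\in\mathcal{B}^\xi$ and a (possibly empty) $\mathbf{s}_{n+1}\in(\mathcal{B}^\xi)^*\setminus\mathcal{B}^\xi$ with $\bigcup_{F\in\mathbf{s}_1}F<\dots<\bigcup_{F\in\mathbf{s}_{n+1}}F$ (ignoring empty collections) and $\mathbf{s}=\bigcup_{i=1}^{n+1}\mathbf{s}_i$.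
   Context: $\mathbb{N}=\{1,2,\dots\}$. For nonempty $s,t\subseteq\mathbb{N}$ with $s$ finite, $s<t$ means $\max s<\min t$. A finite disjoint collection is a tuple $(s_1,\dots,s_k)$, $k\ge0$ ($\emptyset$ for $k=0$), of nonempty finite subsets of $\mathbb{N}$ with $s_1<\dots<s_k$; an infinite disjoint collection is a sequence $(s_n)_{n\in\mathbb{N}}$ of nonempty finite subsets with $s_n<s_{n+1}$; collections are identified with the set of their members. For a family $\mathcal{G}$ of finite disjoint collections, $\mathcal{G}^*=\{\mathbf{t}:\mathbf{t}\text{ is an initial segment of some }\mathbf{s}\in\mathcal{G}\}\cup\{\emptyset\}$. Schreier families: fix for each countable limit $\lambda>0$ a strictly increasing sequence $(\lambda_n)$ of successor ordinals $<\lambda$ with supremum $\lambda$. $\mathcal{A}_0=\{\emptyset\}$; $\mathcal{A}_{\zeta+1}=\{\{n\}\cup s_1:s_1\in\mathcal{A}_\zeta,\{n\}<s_1\}$ ($\{n\}<\emptyset$ vacuous); $\mathcal{A}_{\omega^{\beta+1}}=\{s_1\cup\dots\cup s_n:s_1<\dots<s_n\in\mathcal{A}_{\omega^\beta},n=\min s_1\}$; for limit $\lambda>0$, $\mathcal{A}_{\omega^\lambda}=\{s:s\in\mathcal{A}_{\omega^{\lambda_n}},n=\min s\}$; for limit $\xi$ with $\omega^a<\xi<\omega^{a+1}$, $\xi=p\omega^a+\sum_{i=1}^m p_i\omega^{a_i}$ ($m\ge0$, $p,p_i\ge1$, $a>a_1>\dots>a_m>0$, $p>1$ or $m\ge1$):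 $\mathcal{A}_\xi=\{s_0\cup\dots\cup s_m:s_m<\dots<s_0,\ s_0=s^0_1\cup\dots\cup s^0_p$ with $s^0_1<\dots<s^0_p\in\mathcal{A}_{\omega^a}$, $s_i=s^i_1\cup\dots\cup s^i_{p_i}$ with $s^i_1<\dots<s^i_{p_i}\in\mathcal{A}_{\omega^{a_i}}\}$. For $\xi\ge1$, $\mathcal{B}^\xi=\{(s_1,\dots,s_k):k\ge1,\ s_1<\dots<s_k,\ \{\min s_1,\dots,\min s_k\}\in\mathcal{A}_\xi\}$. -}

module Defs where

open import Data.Nat using (ℕ; zero; suc; _<_; _≤_; _∸_)
open import Data.List using (List; []; _∷_; _++_; concat; map; length; reverse; _∷ʳ_)
open import Data.List.Relation.Unary.All using (All)
open import Data.List.Relation.Unary.Any using (Any)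
open import Data.List.Relation.Unary.Linked using (Linked)
open import Data.List.Membership.Propositional using (_∈_)
open import Data.Product using (Σ; _×_; _,_; proj₁; proj₂)
open import Data.Sum using (_⊎_)
open import Relation.Binary.PropositionalEquality using (_≡_; _≢_)
open import Relation.Nullary using (¬_)

-- Countable ordinals as Brouwer trees (classically, every countable
-- ordinal is the value of some tree and vice versa).  Ordinal equality
-- is the extensional equivalence _≈ₒ_ , not ≡.

data Brw : Set where
  bzero : Brw
  bsuc  : Brw → Brw
  blim  : (ℕ → Brw) → Brw

infix 4 _≤ₒ_ _<ₒ_ _≈ₒ_

data _≤ₒ_ : Brw → Brw → Set where
  z≤ₒ   : ∀ {y} → bzero ≤ₒ y
  s≤ₒs  : ∀ {x y} → x ≤ₒ y → bsuc x ≤ₒ bsuc y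
  ≤ₒlim : ∀ {x f} (n : ℕ) → x ≤ₒ f n → x ≤ₒ blim f
  lim≤ₒ : ∀ {f x} → (∀ n → f n ≤ₒ x) → blim f ≤ₒ x

_<ₒ_ : Brw → Brw → Set
x <ₒ y = bsuc x ≤ₒ y

_≈ₒ_ : Brw → Brw → Set
x ≈ₒ y = (x ≤ₒ y) × (y ≤ₒ x)

infixl 6 _+ₒ_
infixl 7 _*ₒ_

_+ₒ_ : Brw → Brw → Brw
x +ₒ bzero  = x
x +ₒ bsuc y = bsuc (x +ₒ y)
x +ₒ blim f = blim (λ n → x +ₒ f n)

_*ₒ_ : Brw → Brw → Brw
x *ₒ bzero  = bzero
x *ₒ bsuc y = x *ₒ y +ₒ x
x *ₒ blim f = blim (λ n → x *ₒ f n)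

fromℕ : ℕ → Brw
fromℕ zero    = bzero
fromℕ (suc n) = bsuc (fromℕ n)

ω : Brw
ω = blim fromℕ

ω^_ : Brw → Brw
ω^ bzero  = bsuc bzero
ω^ bsuc y = (ω^ y) *ₒ ω
ω^ blim f = blim (λ n → ω^ f n)

IsLimit : Brw → Set
IsLimit l = ¬ (l ≈ₒ bzero) × (∀ ζ → ¬ (l ≈ₒ bsuc ζ))

IsSucc : Brw → Set
IsSucc x = Σ Brw (λ ζ → x ≈ₒ bsuc ζ)

-- A choice, for each countable limit λ > 0, of a strictly increasing
-- sequence of successor ordinals < λ with supremum λ.
-- (fs l p k) is the paper's λ_{k+1}  (paper indexes from 1).
record FundSeq : Set where
  field
    fs       : (l : Brw) → IsLimit l → ℕ → Brw
    fs-resp  : ∀ {l l'} (p : IsLimit l) (p' : IsLimit l') → l ≈ₒ l' →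
               ∀ k → fs l p k ≈ₒ fs l' p' k
    fs-succ  : ∀ l p k → IsSucc (fs l p k)
    fs-incr  : ∀ l p k → fs l p k <ₒ fs l p (suc k)
    fs-below : ∀ l p k → fs l p k <ₒ l
    fs-sup   : ∀ l p → blim (fs l p) ≈ₒ l

-- Finite subsets of ℕ = {1,2,...} are represented canonically by
-- strictly increasing lists of positive naturals.

-- s < t  (max s < min t); vacuous when one side is empty
_≺_ : List ℕ → List ℕ → Set
s ≺ t = All (λ x → All (λ y → x < y) t) s

-- min of a nonempty increasing list (its head); 0 on [] (never used)
minL : List ℕ → ℕ
minL []      = 0
minL (x ∷ _) = x

Canon : List ℕ → Set
Canon s = (s ≢ []) × Linked _<_ s × All (λ x → 1 ≤ x) s

IsColl : List (List ℕ) → Set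
IsColl c = All Canon c × Linked _≺_ c

InfColl : (ℕ → List ℕ) → Set
InfColl D = (∀ n → Canon (D n)) × (∀ n → D n ≺ D (suc n))

-- ordinal value of a Cantor-normal-form list  ω^{e_0}·p_0 + ω^{e_1}·p_1 + ...
-- where each entry is (exponent , list of p_i blocks)
cnf : List (Brw × List (List ℕ)) → Brw
cnf []             = bzero
cnf ((e , b) ∷ r) = (ω^ e) *ₒ fromℕ (length b) +ₒ cnf r

module _ (FS : FundSeq) where
  open FundSeq FS

  data IsA : Brw → List ℕ → Set where
    A-zero : ∀ {ξ} → ξ ≈ₒ bzero → IsA ξ []
    A-suc  : ∀ {ξ ζ n s} → ξ ≈ₒ bsuc ζ → 1 ≤ n → IsA ζ s → (n ∷ []) ≺ s →
             IsA ξ (n ∷ s)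
    A-ωsuc : ∀ {ξ β s} (b : List ℕ) (bs : List (List ℕ)) →
             ξ ≈ₒ ω^ (bsuc β) →
             All (IsA (ω^ β)) (b ∷ bs) → Linked _≺_ (b ∷ bs) →
             length (b ∷ bs) ≡ minL b → s ≡ concat (b ∷ bs) → IsA ξ s
    A-ωlim : ∀ {ξ l n s} (p : IsLimit l) → ξ ≈ₒ ω^ l →
             IsA (ω^ (fs l p (n ∸ 1))) (n ∷ s) → IsA ξ (n ∷ s)
    -- limit ξ with ω^a < ξ < ω^{a+1}, ξ = p ω^a + Σ p_i ω^{a_i}.
    -- parts = (a , blocks_0) ∷ rest, blocks_i = (s^i_1,...,s^i_{p_i}), p_i = length
    A-cnf  : ∀ {ξ s} (a : Brw) (b : List (List ℕ))
               (rest : List (Brw × List (List ℕ))) →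
             IsLimit ξ → ω^ a <ₒ ξ → ξ <ₒ ω^ (bsuc a) →
             ξ ≈ₒ cnf ((a , b) ∷ rest) →
             Linked (λ t u → proj₁ u <ₒ proj₁ t) ((a , b) ∷ rest) →
             All (λ t → bzero <ₒ proj₁ t) rest →
             All (λ t → proj₂ t ≢ []) ((a , b) ∷ rest) →
             ((1 < length b) ⊎ (rest ≢ [])) →
             All (λ t → All (IsA (ω^ proj₁ t)) (proj₂ t)) ((a , b) ∷ rest) →
             All (λ t → Linked _≺_ (proj₂ t)) ((a , b) ∷ rest) →
             Linked _≺_ (reverse (map (λ t → concat (proj₂ t)) ((a , b) ∷ rest))) →
             s ≡ concat (reverse (map (λ t → concat (proj₂ t)) ((a , b) ∷ rest))) →
             IsA ξ s

  B : Brw → List (List ℕ) → Set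
  B ξ c = IsColl c × (c ≢ []) × IsA ξ (map minL c)

  Star : (List (List ℕ) → Set) → List (List ℕ) → Set
  Star G t = (t ≡ []) ⊎ Σ (List (List ℕ)) (λ c → G c × Σ (List (List ℕ)) (λ u → t ++ u ≡ c))

  SeqDecomp : Brw → (ℕ → List ℕ) → (ℕ → List (List ℕ)) → Set
  SeqDecomp ξ D S =
    (∀ n → B ξ (S n)) ×
    (∀ n → concat (S n) ≺ concat (S (suc n))) ×
    (∀ F → ((Σ ℕ λ k → D k ≡ F) → Σ ℕ λ n → F ∈ S n)
         × ((Σ ℕ λ n → F ∈ S n) → Σ ℕ λ k → D k ≡ F))

  FinDecomp : Brw → List (List ℕ) → List (List (List ℕ)) × List (List ℕ) → Set
  FinDecomp ξ s (ss , last) =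
    All (B ξ) ss × Star (B ξ) last × ¬ B ξ last ×
    Linked _≺_ (map concat (ss ∷ʳ last)) ×
    (∀ F → (F ∈ s → Any (F ∈_) ss ⊎ F ∈ last) × (Any (F ∈_) ss ⊎ F ∈ last → F ∈ s))

-- A Schreier family A_ξ (ξ ≥ 1) is thin: no member is a proper initial segment of another.
-- Moreover every increasing sequence of positive integers has an initial segment in A_ξ.
-- Both follow by transfinite induction along the clauses defining A_ξ: the first element n of
-- a set fixes how many A_{ω^β}-blocks make up a member of A_{ω^{β+1}} and which λ_n is used
-- for A_{ω^λ}, and the Cantor normal form of ξ is unique.  (Comparing Brouwer trees needs
-- excluded middle.)
-- Applied to the minima of a disjoint collection, the second fact yields an initial segment
-- in B^ξ, and the first says it is the only one.  Cutting off these segments one after the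
-- other gives the decomposition; uniqueness holds because every cut was forced.  A finite
-- collection is first continued by singletons beyond its maximum; if its initial segment in
-- B^ξ is longer than the collection itself, the collection is the remainder s_{n+1}.

{-# OPTIONS --safe #-}
module Submission where
open import Axiom.ExcludedMiddle using (ExcludedMiddle)
open import Level using (0ℓ)
open import Data.Empty using (⊥-elim)
open import Data.Nat using (ℕ; zero; suc; _+_; _∸_; _<_; _≤_; z≤n; s≤s; _≤?_; _<?_)
import Data.Nat.Properties as ℕₚ
open import Data.List using (List; []; _∷_; _++_; _∷ʳ_; concat; map; length; reverse; replicate; applyUpTo; take; drop)
import Data.List.Properties as Listₚ
open import Data.List.Relation.Unary.All as All using (All; []; _∷_)
import Data.List.Relation.Unary.All.Properties as Allₚ
open import Data.List.Relation.Unary.Any using (Any; here; there)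
import Data.List.Relation.Unary.Any.Properties as Anyₚ
open import Data.List.Relation.Unary.AllPairs using (AllPairs; []; _∷_)
import Data.List.Relation.Unary.AllPairs.Properties as AllPairsₚ
open import Data.List.Relation.Unary.Linked as Linked using (Linked; []; [-]; _∷_)
open import Data.List.Relation.Unary.Linked.Properties using (AllPairs⇒Linked)
open import Data.List.Relation.Binary.Pointwise as Pointwise using (Pointwise; []; _∷_)
open import Data.List.Membership.Propositional using (_∈_)
open import Data.List.Membership.Propositional.Properties
  using (∈-++⁺ˡ; ∈-++⁺ʳ; ∈-++⁻; ∈-concat⁺; ∈-concat⁻; ∈-applyUpTo⁺; ∈-applyUpTo⁻)
open import Data.Product using (Σ; ∃; _×_; _,_; proj₁; proj₂)
open import Data.Sum as Sum using (_⊎_; inj₁; inj₂)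
open import Data.List.Extrema.Nat using (max; xs≤max)
open import Function using (_∘_)
open import Induction.WellFounded using (WellFounded; Acc; acc)
import Induction.WellFounded as WF
open import Relation.Binary using (tri<; tri≈; tri>)
open import Relation.Binary.PropositionalEquality
  using (_≡_; _≢_; refl; sym; trans; cong; cong₂; subst; subst₂)
open import Relation.Nullary using (¬_; Dec; yes; no)

open import Defs

-- Brouwer ordinals

≤ₒ-refl : ∀ {x} → x ≤ₒ x
≤ₒ-refl {bzero}  = z≤ₒ
≤ₒ-refl {bsuc x} = s≤ₒs ≤ₒ-refl
≤ₒ-refl {blim f} = lim≤ₒ (λ n → ≤ₒlim n ≤ₒ-refl)

≤ₒ-trans : ∀ {x y z} → x ≤ₒ y → y ≤ₒ z → x ≤ₒ z
≤ₒ-trans z≤ₒ        q           = z≤ₒ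
≤ₒ-trans (lim≤ₒ p)  q           = lim≤ₒ (λ n → ≤ₒ-trans (p n) q)
≤ₒ-trans p          (≤ₒlim n q) = ≤ₒlim n (≤ₒ-trans p q)
≤ₒ-trans (s≤ₒs p)   (s≤ₒs q)    = s≤ₒs (≤ₒ-trans p q)
≤ₒ-trans (≤ₒlim n p) (lim≤ₒ q)  = ≤ₒ-trans p (q n)

f≤ₒblimf : ∀ {f} n → f n ≤ₒ blim f
f≤ₒblimf n = ≤ₒlim n ≤ₒ-refl

blim≤ₒ⁻¹ : ∀ {f y} n → blim f ≤ₒ y → f n ≤ₒ y
blim≤ₒ⁻¹ n p = ≤ₒ-trans (f≤ₒblimf n) p

x≤ₒbsucx : ∀ x → x ≤ₒ bsuc x
x≤ₒbsucx bzero    = z≤ₒ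
x≤ₒbsucx (bsuc x) = s≤ₒs (x≤ₒbsucx x)
x≤ₒbsucx (blim f) = lim≤ₒ (λ n → ≤ₒ-trans (x≤ₒbsucx (f n)) (s≤ₒs (f≤ₒblimf n)))

<ₒ⇒≤ₒ : ∀ {x y} → x <ₒ y → x ≤ₒ y
<ₒ⇒≤ₒ {x} = ≤ₒ-trans (x≤ₒbsucx x)

s≤ₒs⁻¹ : ∀ {x y} → bsuc x ≤ₒ bsuc y → x ≤ₒ y
s≤ₒs⁻¹ (s≤ₒs p) = p

<ₒblim⁻¹ : ∀ {x f} → x <ₒ blim f → ∃ λ n → x <ₒ f n
<ₒblim⁻¹ (≤ₒlim n p) = n , p

<ₒ-irrefl : ∀ x → ¬ x <ₒ x
<ₒ-irrefl bzero    ()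
<ₒ-irrefl (bsuc x) p = <ₒ-irrefl x (s≤ₒs⁻¹ p)
<ₒ-irrefl (blim f) p with n , q ← <ₒblim⁻¹ p =
  <ₒ-irrefl (f n) (≤ₒ-trans (s≤ₒs (f≤ₒblimf n)) q)

≤ₒ-<ₒ-trans : ∀ {x y z} → x ≤ₒ y → y <ₒ z → x <ₒ z
≤ₒ-<ₒ-trans p = ≤ₒ-trans (s≤ₒs p)

<ₒ-≤ₒ-trans : ∀ {x y z} → x <ₒ y → y ≤ₒ z → x <ₒ z
<ₒ-≤ₒ-trans = ≤ₒ-trans

≤ₒ⇒≯ₒ : ∀ {x y} → x ≤ₒ y → ¬ y <ₒ x
≤ₒ⇒≯ₒ {y = y} p q = <ₒ-irrefl y (≤ₒ-trans q p)

≈ₒ-refl : ∀ {x} → x ≈ₒ x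
≈ₒ-refl = ≤ₒ-refl , ≤ₒ-refl

≈ₒ-sym : ∀ {x y} → x ≈ₒ y → y ≈ₒ x
≈ₒ-sym (p , q) = q , p

≈ₒ-trans : ∀ {x y z} → x ≈ₒ y → y ≈ₒ z → x ≈ₒ z
≈ₒ-trans (p , q) (p' , q') = ≤ₒ-trans p p' , ≤ₒ-trans q' q

≡⇒≈ₒ : ∀ {x y} → x ≡ y → x ≈ₒ y
≡⇒≈ₒ refl = ≈ₒ-refl

bsuc-injective : ∀ {x y} → bsuc x ≈ₒ bsuc y → x ≈ₒ y
bsuc-injective (p , q) = s≤ₒs⁻¹ p , s≤ₒs⁻¹ q

<ₒ-wellFounded : WellFounded _<ₒ_
<ₒ-wellFounded x = acc-≤ₒ x ≤ₒ-refl
  where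
  acc-≤ₒ : ∀ x {y} → y ≤ₒ x → Acc _<ₒ_ y
  acc-<ₒ : ∀ x {y} → y <ₒ x → Acc _<ₒ_ y
  acc-≤ₒ x p = acc (λ q → acc-<ₒ x (≤ₒ-trans q p))
  acc-<ₒ (bsuc x) q = acc-≤ₒ x (s≤ₒs⁻¹ q)
  acc-<ₒ (blim f) q with n , q' ← <ₒblim⁻¹ q = acc-≤ₒ (f n) (<ₒ⇒≤ₒ q')

open WF.All <ₒ-wellFounded 0ℓ using () renaming (wfRec to <ₒ-rec)

x≤ₒx+ₒy : ∀ x y → x ≤ₒ x +ₒ y
x≤ₒx+ₒy x bzero    = ≤ₒ-refl
x≤ₒx+ₒy x (bsuc y) = ≤ₒ-trans (x≤ₒx+ₒy x y) (x≤ₒbsucx _)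
x≤ₒx+ₒy x (blim f) = ≤ₒ-trans (x≤ₒx+ₒy x (f 0)) (f≤ₒblimf 0)

y≤ₒx+ₒy : ∀ x y → y ≤ₒ x +ₒ y
y≤ₒx+ₒy x bzero    = z≤ₒ
y≤ₒx+ₒy x (bsuc y) = s≤ₒs (y≤ₒx+ₒy x y)
y≤ₒx+ₒy x (blim f) = lim≤ₒ (λ n → ≤ₒlim n (y≤ₒx+ₒy x (f n)))

0+ₒy≤ₒy : ∀ y → bzero +ₒ y ≤ₒ y
0+ₒy≤ₒy bzero    = z≤ₒ
0+ₒy≤ₒy (bsuc y) = s≤ₒs (0+ₒy≤ₒy y)
0+ₒy≤ₒy (blim f) = lim≤ₒ (λ n → ≤ₒlim n (0+ₒy≤ₒy (f n)))

+ₒ-monoʳ-≤ₒ : ∀ x {y y'} → y ≤ₒ y' → x +ₒ y ≤ₒ x +ₒ y'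
+ₒ-monoʳ-≤ₒ x {y' = y'} z≤ₒ = x≤ₒx+ₒy x y'
+ₒ-monoʳ-≤ₒ x (s≤ₒs p)      = s≤ₒs (+ₒ-monoʳ-≤ₒ x p)
+ₒ-monoʳ-≤ₒ x (≤ₒlim n p)   = ≤ₒlim n (+ₒ-monoʳ-≤ₒ x p)
+ₒ-monoʳ-≤ₒ x (lim≤ₒ p)     = lim≤ₒ (λ n → +ₒ-monoʳ-≤ₒ x (p n))

+ₒ-monoˡ-≤ₒ : ∀ {x x'} y → x ≤ₒ x' → x +ₒ y ≤ₒ x' +ₒ y
+ₒ-monoˡ-≤ₒ bzero    p = p
+ₒ-monoˡ-≤ₒ (bsuc y) p = s≤ₒs (+ₒ-monoˡ-≤ₒ y p)
+ₒ-monoˡ-≤ₒ (blim f) p = lim≤ₒ (λ n → ≤ₒlim n (+ₒ-monoˡ-≤ₒ (f n) p))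

+ₒ-mono-≤ₒ : ∀ {x x' y y'} → x ≤ₒ x' → y ≤ₒ y' → x +ₒ y ≤ₒ x' +ₒ y'
+ₒ-mono-≤ₒ {x' = x'} {y = y} p q = ≤ₒ-trans (+ₒ-monoˡ-≤ₒ y p) (+ₒ-monoʳ-≤ₒ x' q)

+ₒ-cong : ∀ {x x' y y'} → x ≈ₒ x' → y ≈ₒ y' → x +ₒ y ≈ₒ x' +ₒ y'
+ₒ-cong (p , p') (q , q') = +ₒ-mono-≤ₒ p q , +ₒ-mono-≤ₒ p' q'

*ₒ-monoʳ-≤ₒ : ∀ x {y y'} → y ≤ₒ y' → x *ₒ y ≤ₒ x *ₒ y'
*ₒ-monoʳ-≤ₒ x z≤ₒ         = z≤ₒ
*ₒ-monoʳ-≤ₒ x (s≤ₒs p)    = +ₒ-monoˡ-≤ₒ x (*ₒ-monoʳ-≤ₒ x p)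
*ₒ-monoʳ-≤ₒ x (≤ₒlim n p) = ≤ₒlim n (*ₒ-monoʳ-≤ₒ x p)
*ₒ-monoʳ-≤ₒ x (lim≤ₒ p)   = lim≤ₒ (λ n → *ₒ-monoʳ-≤ₒ x (p n))

*ₒ-monoˡ-≤ₒ : ∀ {x x'} y → x ≤ₒ x' → x *ₒ y ≤ₒ x' *ₒ y
*ₒ-monoˡ-≤ₒ bzero    p = z≤ₒ
*ₒ-monoˡ-≤ₒ (bsuc y) p = +ₒ-mono-≤ₒ (*ₒ-monoˡ-≤ₒ y p) p
*ₒ-monoˡ-≤ₒ (blim f) p = lim≤ₒ (λ n → ≤ₒlim n (*ₒ-monoˡ-≤ₒ (f n) p))

*ₒ-congʳ : ∀ {x x'} y → x ≈ₒ x' → x *ₒ y ≈ₒ x' *ₒ y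
*ₒ-congʳ y (p , q) = *ₒ-monoˡ-≤ₒ y p , *ₒ-monoˡ-≤ₒ y q

*ₒ-identityʳ : ∀ x → x *ₒ fromℕ 1 ≈ₒ x
*ₒ-identityʳ x = 0+ₒy≤ₒy x , y≤ₒx+ₒy bzero x

fromℕ-mono-≤ₒ : ∀ {m n} → m ≤ n → fromℕ m ≤ₒ fromℕ n
fromℕ-mono-≤ₒ z≤n     = z≤ₒ
fromℕ-mono-≤ₒ (s≤s p) = s≤ₒs (fromℕ-mono-≤ₒ p)

0<ₒω^ : ∀ y → bzero <ₒ ω^ y
0<ₒω^ bzero    = ≤ₒ-refl
0<ₒω^ (bsuc y) = ≤ₒlim 1 (≤ₒ-trans (0<ₒω^ y) (y≤ₒx+ₒy bzero (ω^ y)))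
0<ₒω^ (blim f) = ≤ₒlim 0 (0<ₒω^ (f 0))

ω^≉0 : ∀ {x} y → x ≈ₒ ω^ y → ¬ x ≈ₒ bzero
ω^≉0 y (_ , p) (q , _) = <ₒ-irrefl bzero (≤ₒ-trans (0<ₒω^ y) (≤ₒ-trans p q))

ω^<ₒω^bsuc : ∀ x → ω^ x <ₒ ω^ (bsuc x)
ω^<ₒω^bsuc x = ≤ₒlim 2 (≤ₒ-trans (+ₒ-monoʳ-≤ₒ (ω^ x) (0<ₒω^ x))
                                 (+ₒ-monoˡ-≤ₒ (ω^ x) (y≤ₒx+ₒy bzero (ω^ x))))

ω^-mono-≤ₒ : ∀ {x y} → x ≤ₒ y → ω^ x ≤ₒ ω^ y
ω^-mono-≤ₒ {y = y} z≤ₒ  = 0<ₒω^ y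
ω^-mono-≤ₒ (s≤ₒs p)    = *ₒ-monoˡ-≤ₒ ω (ω^-mono-≤ₒ p)
ω^-mono-≤ₒ (≤ₒlim n p) = ≤ₒlim n (ω^-mono-≤ₒ p)
ω^-mono-≤ₒ (lim≤ₒ p)   = lim≤ₒ (λ n → ω^-mono-≤ₒ (p n))

ω^-mono-<ₒ : ∀ {x y} → x <ₒ y → ω^ x <ₒ ω^ y
ω^-mono-<ₒ {x} p = ≤ₒ-trans (ω^<ₒω^bsuc x) (ω^-mono-≤ₒ p)

ω^-cong : ∀ {x y} → x ≈ₒ y → ω^ x ≈ₒ ω^ y
ω^-cong (p , q) = ω^-mono-≤ₒ p , ω^-mono-≤ₒ q

x≤ₒω^x : ∀ x → x ≤ₒ ω^ x
x≤ₒω^x bzero    = z≤ₒ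
x≤ₒω^x (bsuc x) = ≤ₒ-trans (s≤ₒs (x≤ₒω^x x)) (ω^<ₒω^bsuc x)
x≤ₒω^x (blim f) = lim≤ₒ (λ n → ≤ₒ-trans (x≤ₒω^x (f n)) (f≤ₒblimf n))

blim≉bsuc : ∀ {f ζ} → (∀ n → f n <ₒ f (suc n)) → ¬ blim f ≈ₒ bsuc ζ
blim≉bsuc {ζ = ζ} f↑ (p , q) with n , r ← <ₒblim⁻¹ q =
  <ₒ-irrefl ζ (≤ₒ-trans r (s≤ₒs⁻¹ (≤ₒ-trans (f↑ n) (blim≤ₒ⁻¹ (suc n) p))))

ω^bsuc≉bsuc : ∀ {β ζ} → ¬ ω^ (bsuc β) ≈ₒ bsuc ζ
ω^bsuc≉bsuc {β} = blim≉bsuc (λ n → +ₒ-monoʳ-≤ₒ (ω^ β *ₒ fromℕ n) (0<ₒω^ β))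

bsuc≉0 : ∀ {x} → ¬ bsuc x ≈ₒ bzero
bsuc≉0 (() , _)

-- Cantor normal forms

-- A term ω^e · p of a Cantor normal form, p being given (as in Defs.cnf) by a list of p blocks.
Part : Set
Part = Brw × List (List ℕ)

Descending : List Part → Set
Descending = Linked (λ t u → proj₁ u <ₒ proj₁ t)

NF : List Part → Set
NF P = Descending P × All (λ t → proj₂ t ≢ []) P

NF-tail : ∀ {t P} → NF (t ∷ P) → NF P
NF-tail ([-] , _ ∷ ne)    = [] , ne
NF-tail ((_ ∷ l) , _ ∷ ne) = l , ne

descending⇒≤ₒhead : ∀ {t : Part} {ts} → Descending (t ∷ ts) → All (λ u → proj₁ u ≤ₒ proj₁ t) (t ∷ ts)
descending⇒≤ₒhead [-]       = ≤ₒ-refl ∷ []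
descending⇒≤ₒhead (u<t ∷ l) =
  ≤ₒ-refl ∷ All.map (λ v≤u → ≤ₒ-trans v≤u (<ₒ⇒≤ₒ u<t)) (descending⇒≤ₒhead l)

mutual
  cnf-tail<ₒω^ : ∀ {e b r} → NF ((e , b) ∷ r) → cnf r <ₒ ω^ e
  cnf-tail<ₒω^ {e} {r = []}    _              = 0<ₒω^ e
  cnf-tail<ₒω^ {r = (e₁ , b₁) ∷ r} nf@((e₁<e ∷ _) , _) =
    ≤ₒ-trans (cnf<ₒω^bsuc {e₁} {b₁} {r} (NF-tail nf)) (ω^-mono-≤ₒ e₁<e)

  cnf<ₒω^·suc : ∀ {e b r} → NF ((e , b) ∷ r) → cnf ((e , b) ∷ r) <ₒ ω^ e *ₒ fromℕ (suc (length b))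
  cnf<ₒω^·suc {e} {b} nf = +ₒ-monoʳ-≤ₒ (ω^ e *ₒ fromℕ (length b)) (cnf-tail<ₒω^ nf)

  cnf<ₒω^bsuc : ∀ {e b r} → NF ((e , b) ∷ r) → cnf ((e , b) ∷ r) <ₒ ω^ (bsuc e)
  cnf<ₒω^bsuc {b = b} nf = ≤ₒ-trans (cnf<ₒω^·suc nf) (f≤ₒblimf (suc (length b)))

ω^·length≤ₒcnf : ∀ e b r → ω^ e *ₒ fromℕ (length b) ≤ₒ cnf ((e , b) ∷ r)
ω^·length≤ₒcnf e b r = x≤ₒx+ₒy _ (cnf r)

ω^≤ₒω^·length : ∀ e {b : List (List ℕ)} → b ≢ [] → ω^ e ≤ₒ ω^ e *ₒ fromℕ (length b)
ω^≤ₒω^·length e {[]}    b≢[] = ⊥-elim (b≢[] refl)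
ω^≤ₒω^·length e {_ ∷ b} _    = y≤ₒx+ₒy (ω^ e *ₒ fromℕ (length b)) (ω^ e)

ω^≤ₒcnf : ∀ {e b r} → b ≢ [] → ω^ e ≤ₒ cnf ((e , b) ∷ r)
ω^≤ₒcnf {e} {b} {r} b≢[] = ≤ₒ-trans (ω^≤ₒω^·length e b≢[]) (ω^·length≤ₒcnf e b r)

x<ₒx*ₒ2 : ∀ x → bzero <ₒ x → x <ₒ x *ₒ fromℕ 2
x<ₒx*ₒ2 x 0<x = ≤ₒ-trans (+ₒ-monoʳ-≤ₒ x 0<x) (+ₒ-monoˡ-≤ₒ x (y≤ₒx+ₒy bzero x))

ω^<ₒcnf : ∀ {a b rest} → NF ((a , b) ∷ rest) → 1 < length b ⊎ rest ≢ [] → ω^ a <ₒ cnf ((a , b) ∷ rest)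
ω^<ₒcnf {b = []}    _ (inj₁ ())
ω^<ₒcnf {b = _ ∷ []} _ (inj₁ (s≤s ()))
ω^<ₒcnf {a} {x ∷ y ∷ b} {rest} _ (inj₁ _) =
  ≤ₒ-trans (x<ₒx*ₒ2 (ω^ a) (0<ₒω^ a))
    (≤ₒ-trans (*ₒ-monoʳ-≤ₒ (ω^ a) (fromℕ-mono-≤ₒ {2} {2 + length b} (s≤s (s≤s z≤n))))
              (ω^·length≤ₒcnf a (x ∷ y ∷ b) rest))
ω^<ₒcnf {rest = []} _ (inj₂ rest≢[]) = ⊥-elim (rest≢[] refl)
ω^<ₒcnf {a} {b} {(e₁ , b₁) ∷ r} nf (inj₂ _) =
  ≤ₒ-<ₒ-trans (ω^≤ₒω^·length a (All.head (proj₂ nf)))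
    (+ₒ-monoʳ-≤ₒ (ω^ a *ₒ fromℕ (length b))
      (≤ₒ-trans (0<ₒω^ e₁) (ω^≤ₒcnf {e₁} {b₁} {r} (All.head (All.tail (proj₂ nf))))))

NotSucc : Brw → Set
NotSucc ξ = ∀ ζ → ¬ ξ ≈ₒ bsuc ζ

HasCNF : Brw → Set
HasCNF ξ = ∃ λ P → NF P × All (λ t → bzero <ₒ proj₁ t) P × ξ ≈ₒ cnf P

HasCNF-resp : ∀ {ξ η} → ξ ≈ₒ η → HasCNF ξ → HasCNF η
HasCNF-resp ξ≈η (P , nf , pos , ξ≈) = P , nf , pos , ≈ₒ-trans (≈ₒ-sym ξ≈η) ξ≈

cnf≉0 : ∀ {e b r} → b ≢ [] → ¬ cnf ((e , b) ∷ r) ≈ₒ bzero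
cnf≉0 {e} {b} {r} b≢[] (p , _) = <ₒ-irrefl bzero (≤ₒ-trans (0<ₒω^ e) (≤ₒ-trans (ω^≤ₒcnf {e} {b} {r} b≢[]) p))

cnf-coefficient-mono : ∀ {e b r e' b' r'} → NF ((e , b) ∷ r) → e ≤ₒ e' →
  cnf ((e' , b') ∷ r') ≤ₒ cnf ((e , b) ∷ r) → ¬ length b < length b'
cnf-coefficient-mono {e} {b} {r} {e'} {b'} {r'} nf e≤e' p lt =
  <ₒ-irrefl _ (≤ₒ-trans (cnf<ₒω^·suc nf)
    (≤ₒ-trans (*ₒ-monoʳ-≤ₒ (ω^ e) (fromℕ-mono-≤ₒ lt))
    (≤ₒ-trans (*ₒ-monoˡ-≤ₒ (fromℕ (length b')) (ω^-mono-≤ₒ e≤e'))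
    (≤ₒ-trans (ω^·length≤ₒcnf e' b' r') p))))

EquivShape : Part → Part → Set
EquivShape t t' = proj₁ t ≈ₒ proj₁ t' × length (proj₂ t) ≡ length (proj₂ t')

SameShape : Part → Part → Set
SameShape t u = proj₁ t ≡ proj₁ u × length (proj₂ t) ≡ length (proj₂ u)

cnf-sameShape : ∀ {P Q} → Pointwise SameShape P Q → cnf P ≡ cnf Q
cnf-sameShape [] = refl
cnf-sameShape {(e , _) ∷ _} ((refl , l) ∷ eqs) = cong₂ (λ k c → ω^ e *ₒ fromℕ k +ₒ c) l (cnf-sameShape eqs)

descending-sameShape : ∀ {P Q} → Pointwise SameShape P Q →
  Descending P → Descending Q
descending-sameShape []                 []      = []
descending-sameShape (_ ∷ [])           [-]     = [-]
descending-sameShape (e₁ ∷ e₂ ∷ eqs) (r ∷ l) =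
  subst₂ (λ x y → y <ₒ x) (proj₁ e₁) (proj₁ e₂) r ∷ descending-sameShape (e₂ ∷ eqs) l

positive-sameShape : ∀ {P Q} → Pointwise SameShape P Q →
  All (λ t → bzero <ₒ proj₁ t) P → All (λ t → bzero <ₒ proj₁ t) Q
positive-sameShape eqs pos = Pointwise.All-resp-Pointwise (λ e → subst (bzero <ₒ_) (proj₁ e)) eqs pos

nonempty-sameShape : ∀ {P Q} → Pointwise SameShape P Q → All (λ t → proj₂ t ≢ []) P → All (λ t → proj₂ t ≢ []) Q
nonempty-sameShape eqs ne = Pointwise.All-resp-Pointwise resp eqs ne
  where
  resp : ∀ {t u} → SameShape t u → proj₂ t ≢ [] → proj₂ u ≢ []
  resp {_ , []}    _ t≢[] = ⊥-elim (t≢[] refl)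
  resp {_ , _ ∷ _} {_ , _ ∷ _} _ _ ()

-- Consequences of excluded middle

module _ (em : ExcludedMiddle 0ℓ) where

  ≤ₒ⊎>ₒ : ∀ x y → x ≤ₒ y ⊎ y <ₒ x
  ≤ₒ⊎>ₒ bzero    y        = inj₁ z≤ₒ
  ≤ₒ⊎>ₒ (bsuc x) bzero    = inj₂ (s≤ₒs z≤ₒ)
  ≤ₒ⊎>ₒ (bsuc x) (bsuc y) with ≤ₒ⊎>ₒ x y
  ... | inj₁ p = inj₁ (s≤ₒs p)
  ... | inj₂ q = inj₂ (s≤ₒs q)
  ≤ₒ⊎>ₒ (bsuc x) (blim g) with em {∃ λ n → bsuc x ≤ₒ g n}
  ... | yes (n , p) = inj₁ (≤ₒlim n p)
  ... | no ∄ = inj₂ (s≤ₒs (lim≤ₒ g≤x))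
    where
    g≤x : ∀ n → g n ≤ₒ x
    g≤x n with ≤ₒ⊎>ₒ (bsuc x) (g n)
    ... | inj₁ p = ⊥-elim (∄ (n , p))
    ... | inj₂ q = s≤ₒs⁻¹ q
  ≤ₒ⊎>ₒ (blim f) y with em {∃ λ n → y <ₒ f n}
  ... | yes (n , p) = inj₂ (≤ₒlim n p)
  ... | no ∄ = inj₁ (lim≤ₒ f≤y)
    where
    f≤y : ∀ n → f n ≤ₒ y
    f≤y n with ≤ₒ⊎>ₒ (f n) y
    ... | inj₁ p = p
    ... | inj₂ q = ⊥-elim (∄ (n , q))

  ≮ₒ⇒≥ₒ : ∀ {x y} → ¬ x <ₒ y → y ≤ₒ x
  ≮ₒ⇒≥ₒ {x} {y} x≮y with ≤ₒ⊎>ₒ y x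
  ... | inj₁ p = p
  ... | inj₂ q = ⊥-elim (x≮y q)

  minimal : (P : Brw → Set) → ∀ {z} → P z → ∃ λ m → P m × (∀ {w} → w <ₒ m → ¬ P w)
  minimal P {z} = <ₒ-rec (λ z → P z → ∃ λ m → P m × (∀ {w} → w <ₒ m → ¬ P w)) step z
    where
    step : ∀ z → (∀ {w} → w <ₒ z → P w → ∃ λ m → P m × (∀ {w} → w <ₒ m → ¬ P w)) →
           P z → ∃ λ m → P m × (∀ {w} → w <ₒ m → ¬ P w)
    step z rec pz with em {∃ λ w → w <ₒ z × P w}
    ... | yes (w , w<z , pw) = rec w<z pw
    ... | no ∄ = z , pz , λ w<z pw → ∄ (_ , w<z , pw)

  +ₒ-cancelˡ-≤ₒ : ∀ x {y z} → x +ₒ y ≤ₒ x +ₒ z → y ≤ₒ z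
  +ₒ-cancelˡ-≤ₒ x p = ≮ₒ⇒≥ₒ (λ z<y → ≤ₒ⇒≯ₒ p (+ₒ-monoʳ-≤ₒ x z<y))

  ω^-cancel-≤ₒ : ∀ {x y} → ω^ x ≤ₒ ω^ y → x ≤ₒ y
  ω^-cancel-≤ₒ p = ≮ₒ⇒≥ₒ (λ y<x → ≤ₒ⇒≯ₒ p (ω^-mono-<ₒ y<x))

  ω^-cancel-<ₒ : ∀ {x y} → ω^ x <ₒ ω^ y → x <ₒ y
  ω^-cancel-<ₒ {x} {y} p with ≤ₒ⊎>ₒ y x
  ... | inj₁ y≤x = ⊥-elim (≤ₒ⇒≯ₒ (ω^-mono-≤ₒ y≤x) p)
  ... | inj₂ x<y = x<y

  ω^-injective : ∀ {x y} → ω^ x ≈ₒ ω^ y → x ≈ₒ y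
  ω^-injective (p , q) = ω^-cancel-≤ₒ p , ω^-cancel-≤ₒ q

  ω^≈bsuc⇒≈0 : ∀ x {ζ} → ω^ x ≈ₒ bsuc ζ → x ≈ₒ bzero
  ω^≈bsuc⇒≈0 bzero    e = ≈ₒ-refl
  ω^≈bsuc⇒≈0 (bsuc x) e = ⊥-elim (ω^bsuc≉bsuc {x} e)
  ω^≈bsuc⇒≈0 (blim f) (p , q) with n , r ← <ₒblim⁻¹ q = lim≤ₒ fm≤0 , z≤ₒ
    where
    fn≈0 : f n ≈ₒ bzero
    fn≈0 = ω^≈bsuc⇒≈0 (f n) (blim≤ₒ⁻¹ n p , r)
    fm≤0 : ∀ m → f m ≤ₒ bzero
    fm≤0 m = ≤ₒ-trans (≮ₒ⇒≥ₒ (λ fn<fm → ≤ₒ⇒≯ₒ (≤ₒ-trans (blim≤ₒ⁻¹ {f = ω^_ ∘ f} m p) r)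
                                                     (ω^-mono-<ₒ fn<fm)))
                      (proj₁ fn≈0)

  ≤ₒ⇒≈+ₒ : ∀ {x y} → x ≤ₒ y → ∃ λ r → y ≈ₒ x +ₒ r
  ≤ₒ⇒≈+ₒ {x} {y} x≤y with m , y≤x+m , m-min ← minimal (λ r → y ≤ₒ x +ₒ r) (y≤ₒx+ₒy x y) =
    m , y≤x+m , x+≤y m ≤ₒ-refl
    where
    x+≤y : ∀ z → z ≤ₒ m → x +ₒ z ≤ₒ y
    x+≤y bzero    _   = x≤y
    x+≤y (bsuc z) z<m = ≮ₒ⇒≥ₒ (λ y≤x+z → m-min z<m (s≤ₒs⁻¹ y≤x+z))
    x+≤y (blim g) g≤m = lim≤ₒ (λ n → x+≤y (g n) (blim≤ₒ⁻¹ n g≤m))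

  ω^-bracket : ∀ {ξ} → ¬ ξ ≈ₒ bzero → ∃ λ a → ω^ a ≤ₒ ξ × ξ <ₒ ω^ (bsuc a)
  ω^-bracket {ξ} ξ≉0 = below (bsuc ξ) (≤ₒ-<ₒ-trans (x≤ₒω^x ξ) (ω^<ₒω^bsuc ξ))
    where
    below : ∀ a → ξ <ₒ ω^ a → ∃ λ a → ω^ a ≤ₒ ξ × ξ <ₒ ω^ (bsuc a)
    below bzero    ξ<1 = ⊥-elim (ξ≉0 (s≤ₒs⁻¹ ξ<1 , z≤ₒ))
    below (bsuc a) ξ<  with ≤ₒ⊎>ₒ (ω^ a) ξ
    ... | inj₁ ≤ξ = a , ≤ξ , ξ<
    ... | inj₂ ξ<' = below a ξ<'
    below (blim f) ξ<  with n , ξ<' ← <ₒblim⁻¹ ξ< = below (f n) ξ<'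

  leading-coefficient : ∀ {ξ a} → ω^ a ≤ₒ ξ → ξ <ₒ ω^ (bsuc a) →
    ∃ λ k → ω^ a *ₒ fromℕ (suc k) ≤ₒ ξ × ξ <ₒ ω^ a *ₒ fromℕ (suc (suc k))
  leading-coefficient {ξ} {a} lo hi with n , ξ< ← <ₒblim⁻¹ hi = positive (below n ξ<)
    where
    Between : ℕ → Set
    Between k = ω^ a *ₒ fromℕ k ≤ₒ ξ × ξ <ₒ ω^ a *ₒ fromℕ (suc k)
    below : ∀ n → ξ <ₒ ω^ a *ₒ fromℕ n → ∃ Between
    below (suc k) ξ< with ≤ₒ⊎>ₒ (ω^ a *ₒ fromℕ k) ξ
    ... | inj₁ ≤ξ  = k , ≤ξ , ξ<
    ... | inj₂ ξ<' = below k ξ<'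
    positive : ∃ Between → ∃ λ k → Between (suc k)
    positive (zero , _ , ξ<) = ⊥-elim (<ₒ-irrefl _ (≤ₒ-trans ξ< (≤ₒ-trans (proj₁ (*ₒ-identityʳ (ω^ a))) lo)))
    positive (suc k , b) = k , b

  cnf-cons : ∀ {a r} k → bzero <ₒ a → r <ₒ ω^ a → HasCNF r → HasCNF (ω^ a *ₒ fromℕ (suc k) +ₒ r)
  cnf-cons {a} {r} k 0<a r<ω^a (P , nf , pos , r≈) =
    (a , replicate (suc k) []) ∷ P , (descending nf r≈ , (λ ()) ∷ proj₂ nf) , 0<a ∷ pos ,
    +ₒ-cong (≡⇒≈ₒ (cong (λ n → ω^ a *ₒ fromℕ n) (sym (Listₚ.length-replicate (suc k))))) r≈
    where
    descending : ∀ {Q} → NF Q → r ≈ₒ cnf Q → Descending ((a , replicate (suc k) []) ∷ Q)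
    descending {[]}    _  _  = [-]
    descending {(e₁ , b₁) ∷ Q} nf r≈ =
      ω^-cancel-<ₒ (≤ₒ-<ₒ-trans (≤ₒ-trans (ω^≤ₒcnf {e₁} {b₁} {Q} (All.head (proj₂ nf))) (proj₂ r≈)) r<ω^a)
        ∷ proj₁ nf

  leading-term : ∀ {ξ} → ¬ ξ ≈ₒ bzero →
    ∃ λ a → ∃ λ k → ∃ λ r → ξ ≈ₒ ω^ a *ₒ fromℕ (suc k) +ₒ r × r <ₒ ω^ a
  leading-term ξ≉0 =
    let a , lo , hi   = ω^-bracket ξ≉0
        k , klo , khi = leading-coefficient {a = a} lo hi
        r , ξ≈        = ≤ₒ⇒≈+ₒ klo
    in a , k , r , ξ≈ , +ₒ-cancelˡ-≤ₒ _ (≤ₒ-<ₒ-trans (proj₂ ξ≈) khi)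

  cnf-exists : ∀ ξ → NotSucc ξ → HasCNF ξ
  cnf-exists = <ₒ-rec (λ ξ → NotSucc ξ → HasCNF ξ) step
    where
    step : ∀ ξ → (∀ {η} → η <ₒ ξ → NotSucc η → HasCNF η) → NotSucc ξ → HasCNF ξ
    step ξ rec ns with em {ξ ≈ₒ bzero}
    ... | yes ξ≈0 = [] , ([] , []) , [] , ξ≈0
    ... | no ξ≉0 with a , k , r , ξ≈ , r<ω^a ← leading-term ξ≉0 =
      HasCNF-resp (≈ₒ-sym ξ≈) (cnf-cons k 0<a r<ω^a (rec r<ξ r-notSucc))
      where
      X : Brw
      X = ω^ a *ₒ fromℕ (suc k)
      r<ξ : r <ₒ ξ
      r<ξ = <ₒ-≤ₒ-trans r<ω^a
              (≤ₒ-trans (y≤ₒx+ₒy (ω^ a *ₒ fromℕ k) (ω^ a)) (≤ₒ-trans (x≤ₒx+ₒy X r) (proj₂ ξ≈)))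
      r-notSucc : NotSucc r
      r-notSucc ζ r≈ = ns (X +ₒ ζ) (≈ₒ-trans ξ≈ (+ₒ-cong ≈ₒ-refl r≈))
      -- if a ≈ 0 then r < 1, so ξ ≈ k + 1 would be a successor
      0<a : bzero <ₒ a
      0<a with ≤ₒ⊎>ₒ a bzero
      ... | inj₂ 0<a = 0<a
      ... | inj₁ a≤0 = ⊥-elim (ns (bsuc bzero *ₒ fromℕ k)
             (≈ₒ-trans ξ≈ (+ₒ-cong (*ₒ-congʳ (fromℕ (suc k)) (ω^-mono-≤ₒ a≤0 , 0<ₒω^ a))
                                   (s≤ₒs⁻¹ (≤ₒ-trans r<ω^a (ω^-mono-≤ₒ a≤0)) , z≤ₒ))))

  cnf-exponent-mono : ∀ {e b r e' b' r'} → NF ((e , b) ∷ r) → NF ((e' , b') ∷ r') →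
    cnf ((e , b) ∷ r) ≤ₒ cnf ((e' , b') ∷ r') → e ≤ₒ e'
  cnf-exponent-mono {e} {b} {r} nf nf' p =
    s≤ₒs⁻¹ (ω^-cancel-<ₒ (≤ₒ-<ₒ-trans (≤ₒ-trans (ω^≤ₒcnf {e} {b} {r} (All.head (proj₂ nf))) p)
                                      (cnf<ₒω^bsuc nf')))

  cnf-injective : ∀ P P' → NF P → NF P' → cnf P ≈ₒ cnf P' → Pointwise EquivShape P P'
  cnf-injective []      []      _  _   _  = []
  cnf-injective []            ((e , b) ∷ r) _  nf' eq = ⊥-elim (cnf≉0 {e} {b} {r} (All.head (proj₂ nf')) (≈ₒ-sym eq))
  cnf-injective ((e , b) ∷ r) []            nf _   eq = ⊥-elim (cnf≉0 {e} {b} {r} (All.head (proj₂ nf)) eq)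
  cnf-injective ((e , b) ∷ r) ((e' , b') ∷ r') nf nf' eq =
    (e≈e' , |b|≡|b'|) ∷ cnf-injective r r' (NF-tail nf) (NF-tail nf') tails≈
    where
    e≈e' : e ≈ₒ e'
    e≈e' = cnf-exponent-mono nf nf' (proj₁ eq) , cnf-exponent-mono nf' nf (proj₂ eq)
    |b|≡|b'| : length b ≡ length b'
    |b|≡|b'| with ℕₚ.<-cmp (length b) (length b')
    ... | tri< lt _ _ = ⊥-elim (cnf-coefficient-mono {b' = b'} {r'} nf (proj₁ e≈e') (proj₂ eq) lt)
    ... | tri≈ _ ≡ _  = ≡
    ... | tri> _ _ gt = ⊥-elim (cnf-coefficient-mono {b' = b} {r} nf' (proj₂ e≈e') (proj₁ eq) gt)
    heads≈ : ω^ e *ₒ fromℕ (length b) ≈ₒ ω^ e' *ₒ fromℕ (length b')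
    heads≈ = ≈ₒ-trans (*ₒ-congʳ (fromℕ (length b)) (ω^-cong e≈e'))
                      (≡⇒≈ₒ (cong (λ n → ω^ e' *ₒ fromℕ n) |b|≡|b'|))
    eq' : ω^ e *ₒ fromℕ (length b) +ₒ cnf r ≈ₒ ω^ e *ₒ fromℕ (length b) +ₒ cnf r'
    eq' = ≈ₒ-trans eq (+ₒ-cong (≈ₒ-sym heads≈) (≈ₒ-refl {cnf r'}))
    tails≈ : cnf r ≈ₒ cnf r'
    tails≈ = +ₒ-cancelˡ-≤ₒ _ (proj₁ eq') , +ₒ-cancelˡ-≤ₒ _ (proj₂ eq')

  ≈ω^-≈ω^⇒≈ : ∀ {ξ} x y → ξ ≈ₒ ω^ x → ξ ≈ₒ ω^ y → x ≈ₒ y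
  ≈ω^-≈ω^⇒≈ _ _ p q = ω^-injective (≈ₒ-trans (≈ₒ-sym p) q)

  ≈bsuc-≈ω^⇒≈0 : ∀ {ξ ζ} x → ξ ≈ₒ bsuc ζ → ξ ≈ₒ ω^ x → x ≈ₒ bzero
  ≈bsuc-≈ω^⇒≈0 x p q = ω^≈bsuc⇒≈0 x (≈ₒ-trans (≈ₒ-sym q) p)

  ω^-not-between : ∀ {ξ} x a → ξ ≈ₒ ω^ x → ω^ a <ₒ ξ → ¬ ξ <ₒ ω^ (bsuc a)
  ω^-not-between x a ξ≈ lo hi =
    ≤ₒ⇒≯ₒ (s≤ₒs⁻¹ (ω^-cancel-<ₒ {x} {bsuc a} (≤ₒ-<ₒ-trans (proj₂ ξ≈) hi)))
          (ω^-cancel-<ₒ {a} {x} (<ₒ-≤ₒ-trans lo (proj₁ ξ≈)))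

_⊑_ : {A : Set} → List A → List A → Set
xs ⊑ ys = ∃ λ zs → xs ++ zs ≡ ys

Comparable : {A : Set} → List A → List A → Set
Comparable xs ys = xs ⊑ ys ⊎ ys ⊑ xs

module _ {A : Set} where

  comparable-sym : {xs ys : List A} → Comparable xs ys → Comparable ys xs
  comparable-sym (inj₁ p) = inj₂ p
  comparable-sym (inj₂ p) = inj₁ p

  ++≡++⇒comparable : (xs ys : List A) {us vs : List A} → xs ++ us ≡ ys ++ vs → Comparable xs ys
  ++≡++⇒comparable []       ys       e = inj₁ (ys , refl)
  ++≡++⇒comparable (x ∷ xs) []       e = inj₂ (x ∷ xs , refl)
  ++≡++⇒comparable (x ∷ xs) (y ∷ ys) e with refl , e' ← Listₚ.∷-injective e
    with ++≡++⇒comparable xs ys e'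
  ... | inj₁ (zs , p) = inj₁ (zs , cong (x ∷_) p)
  ... | inj₂ (zs , p) = inj₂ (zs , cong (x ∷_) p)

  comparable-++⁻ : {xs ys us vs : List A} → Comparable (xs ++ us) (ys ++ vs) → Comparable xs ys
  comparable-++⁻ {xs} {ys} {us} (inj₁ (zs , e)) =
    ++≡++⇒comparable xs ys (trans (sym (Listₚ.++-assoc xs us zs)) e)
  comparable-++⁻ {xs} {ys} {vs = vs} (inj₂ (zs , e)) =
    comparable-sym (++≡++⇒comparable ys xs (trans (sym (Listₚ.++-assoc ys vs zs)) e))

  ⊑-++-cancelˡ : (xs : List A) {us vs : List A} → (xs ++ us) ⊑ (xs ++ vs) → us ⊑ vs
  ⊑-++-cancelˡ xs {us} (zs , e) = zs , Listₚ.++-cancelˡ xs _ _ (trans (sym (Listₚ.++-assoc xs us zs)) e)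

  comparable-++-cancelˡ : (xs : List A) {us vs : List A} → Comparable (xs ++ us) (xs ++ vs) → Comparable us vs
  comparable-++-cancelˡ xs (inj₁ p) = inj₁ (⊑-++-cancelˡ xs p)
  comparable-++-cancelˡ xs (inj₂ p) = inj₂ (⊑-++-cancelˡ xs p)

  comparable-∷⁻ : {x y : A} {xs ys : List A} → Comparable (x ∷ xs) (y ∷ ys) → x ≡ y × Comparable xs ys
  comparable-∷⁻ (inj₁ (zs , e)) with refl , e' ← Listₚ.∷-injective e = refl , inj₁ (zs , e')
  comparable-∷⁻ (inj₂ (zs , e)) with refl , e' ← Listₚ.∷-injective e = refl , inj₂ (zs , e')

  comparable-map : {B : Set} (f : A → B) {xs ys : List A} → Comparable xs ys → Comparable (map f xs) (map f ys)
  comparable-map f {xs} (inj₁ (zs , e)) = inj₁ (map f zs , trans (sym (Listₚ.map-++ f xs zs)) (cong (map f) e))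
  comparable-map f {ys = ys} (inj₂ (zs , e)) = inj₂ (map f zs , trans (sym (Listₚ.map-++ f ys zs)) (cong (map f) e))

  ⊑-length⇒≡ : {xs ys : List A} → xs ⊑ ys → length xs ≡ length ys → xs ≡ ys
  ⊑-length⇒≡ {xs} ([] , e) _ = trans (sym (Listₚ.++-identityʳ xs)) e
  ⊑-length⇒≡ {xs} (z ∷ zs , e) |xs|≡|ys| = ⊥-elim (ℕₚ.m≢1+n+m (length xs) |xs|≡1+|zs|+|xs|)
    where
    |xs|≡1+|zs|+|xs| : length xs ≡ suc (length zs + length xs)
    |xs|≡1+|zs|+|xs| = trans |xs|≡|ys| (trans (cong length (sym e))
                       (trans (Listₚ.length-++ xs) (ℕₚ.+-comm (length xs) _)))

  comparable-length⇒≡ : {xs ys : List A} → Comparable xs ys → length xs ≡ length ys → xs ≡ ys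
  comparable-length⇒≡ (inj₁ p) l = ⊑-length⇒≡ p l
  comparable-length⇒≡ (inj₂ p) l = sym (⊑-length⇒≡ p (sym l))

  concat-∷ʳ : (xss : List (List A)) (xs : List A) → concat (xss ∷ʳ xs) ≡ concat xss ++ xs
  concat-∷ʳ xss xs = trans (sym (Listₚ.concat-++ xss (xs ∷ []))) (cong (concat xss ++_) (Listₚ.++-identityʳ xs))

  concat-comparable⇒≡ : (xss yss : List (List A)) → Pointwise (λ xs ys → Comparable xs ys → xs ≡ ys) xss yss →
    Comparable (concat xss) (concat yss) → xss ≡ yss
  concat-comparable⇒≡ [] [] [] _ = refl
  concat-comparable⇒≡ (xs ∷ xss) (ys ∷ yss) (thin ∷ thins) c with refl ← thin (comparable-++⁻ c) =
    cong (xs ∷_) (concat-comparable⇒≡ xss yss thins (comparable-++-cancelˡ xs c))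

  concat-reverse-∷ : {B : Set} (h : B → List A) (t : B) (ts : List B) →
    concat (reverse (map h (t ∷ ts))) ≡ concat (reverse (map h ts)) ++ h t
  concat-reverse-∷ h t ts =
    trans (cong concat (Listₚ.unfold-reverse (h t) (map h ts))) (concat-∷ʳ (reverse (map h ts)) (h t))

  concat-reverse-comparable⇒≡ : {B : Set} (g : B → List (List A)) (ts us : List B) →
    Pointwise (λ t u → Pointwise (λ xs ys → Comparable xs ys → xs ≡ ys) (g t) (g u)) ts us →
    Comparable (concat (reverse (map (concat ∘ g) ts))) (concat (reverse (map (concat ∘ g) us))) →
    map g ts ≡ map g us
  concat-reverse-comparable⇒≡ g [] [] [] _ = refl
  concat-reverse-comparable⇒≡ g (t ∷ ts) (u ∷ us) (thin ∷ thins) c₀ = cong₂ _∷_ heads tails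
    where
    h = concat ∘ g
    c : Comparable (concat (reverse (map h ts)) ++ h t) (concat (reverse (map h us)) ++ h u)
    c = subst₂ Comparable (concat-reverse-∷ h t ts) (concat-reverse-∷ h u us) c₀
    tails : map g ts ≡ map g us
    tails = concat-reverse-comparable⇒≡ g ts us thins (comparable-++⁻ c)
    prefixes : concat (reverse (map h ts)) ≡ concat (reverse (map h us))
    prefixes = cong (concat ∘ reverse)
      (trans (Listₚ.map-∘ ts) (trans (cong (map concat) tails) (sym (Listₚ.map-∘ us))))
    heads : g t ≡ g u
    heads = concat-comparable⇒≡ (g t) (g u) thin
      (comparable-++-cancelˡ (concat (reverse (map h ts)))
        (subst (λ z → Comparable (concat (reverse (map h ts)) ++ h t) (z ++ h u)) (sym prefixes) c))

comparable-minL : ∀ {b b' x y : List ℕ} → b ≢ [] → b' ≢ [] → Comparable (b ++ x) (b' ++ y) → minL b ≡ minL b'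
comparable-minL {[]}    b≢[] _     _ = ⊥-elim (b≢[] refl)
comparable-minL {_ ∷ _} {[]} _ b'≢[] _ = ⊥-elim (b'≢[] refl)
comparable-minL {_ ∷ _} {_ ∷ _} _ _ c = proj₁ (comparable-∷⁻ c)

module _ {A : Set} {x : A} where

  ∈-concat-++⁻ : ∀ xss {ys} → x ∈ concat xss ++ ys → Any (x ∈_) xss ⊎ x ∈ ys
  ∈-concat-++⁻ xss x∈ with ∈-++⁻ (concat xss) x∈
  ... | inj₁ x∈xss = inj₁ (∈-concat⁻ xss x∈xss)
  ... | inj₂ x∈ys  = inj₂ x∈ys

  ∈-concat-++⁺ : ∀ xss {ys} → Any (x ∈_) xss ⊎ x ∈ ys → x ∈ concat xss ++ ys
  ∈-concat-++⁺ xss (inj₁ x∈xss) = ∈-++⁺ˡ (∈-concat⁺ x∈xss)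
  ∈-concat-++⁺ xss (inj₂ x∈ys)  = ∈-++⁺ʳ (concat xss) x∈ys

Pointwise-fromAll : {A B : Set} {P : A → Set} {Q : B → Set} {R : A → B → Set} →
  (∀ {x y} → P x → Q y → R x y) → ∀ {xs ys} → All P xs → All Q ys → length xs ≡ length ys → Pointwise R xs ys
Pointwise-fromAll f []       []       _ = []
Pointwise-fromAll f (p ∷ ps) (q ∷ qs) l = f p q ∷ Pointwise-fromAll f ps qs (ℕₚ.suc-injective l)

Pointwise-zipAll : {A B : Set} {S R : A → B → Set} {P : A → Set} {Q : B → Set} →
  (∀ {x y} → S x y → P x → Q y → R x y) → ∀ {xs ys} → Pointwise S xs ys → All P xs → All Q ys → Pointwise R xs ys
Pointwise-zipAll f []       []       []       = []
Pointwise-zipAll f (s ∷ ss) (p ∷ ps) (q ∷ qs) = f s p q ∷ Pointwise-zipAll f ss ps qs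

All-swap : {A B : Set} {R : A → B → Set} {xs : List A} (ys : List B) →
  All (λ y → All (λ x → R x y) xs) ys → All (λ x → All (R x) ys) xs
All-swap {xs = []}    ys p = []
All-swap {xs = _ ∷ _} ys p = All.map All.head p ∷ All-swap ys (All.map All.tail p)

Linked-++⁻ˡ : {A : Set} {R : A → A → Set} (xs : List A) {ys : List A} → Linked R (xs ++ ys) → Linked R xs
Linked-++⁻ˡ []           _       = []
Linked-++⁻ˡ (x ∷ [])     _       = [-]
Linked-++⁻ˡ (x ∷ y ∷ xs) (r ∷ l) = r ∷ Linked-++⁻ˡ (y ∷ xs) l

Linked-++⁻ʳ : {A : Set} {R : A → A → Set} (xs : List A) {ys : List A} → Linked R (xs ++ ys) → Linked R ys
Linked-++⁻ʳ []       l = l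
Linked-++⁻ʳ (x ∷ xs) l = Linked-++⁻ʳ xs (Linked.tail l)

Linked-∷ʳ⁺ : {A : Set} {R : A → A → Set} {y : A} {xs : List A} →
  Linked R xs → All (λ x → R x y) xs → Linked R (xs ∷ʳ y)
Linked-∷ʳ⁺ []      _        = [-]
Linked-∷ʳ⁺ [-]     (p ∷ []) = p ∷ [-]
Linked-∷ʳ⁺ (r ∷ l) (_ ∷ ps) = r ∷ Linked-∷ʳ⁺ l ps

Linked-∷⁺ : {A : Set} {R : A → A → Set} {x : A} {ys : List A} → All (R x) ys → Linked R ys → Linked R (x ∷ ys)
Linked-∷⁺ []      _ = [-]
Linked-∷⁺ (p ∷ _) l = p ∷ l

shift : {A : Set} → ℕ → (ℕ → A) → ℕ → A
shift j f i = f (j + i)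

module _ {A : Set} where

  applyUpTo-+ : (f : ℕ → A) (m n : ℕ) → applyUpTo f (m + n) ≡ applyUpTo f m ++ applyUpTo (shift m f) n
  applyUpTo-+ f zero    n = refl
  applyUpTo-+ f (suc m) n = cong (f 0 ∷_) (applyUpTo-+ (f ∘ suc) m n)

  applyUpTo-cong : {f g : ℕ → A} → (∀ i → f i ≡ g i) → ∀ n → applyUpTo f n ≡ applyUpTo g n
  applyUpTo-cong f≗g zero    = refl
  applyUpTo-cong f≗g (suc n) = cong₂ _∷_ (f≗g 0) (applyUpTo-cong (f≗g ∘ suc) n)

  applyUpTo-⊑ : (f : ℕ → A) {m n : ℕ} → m ≤ n → applyUpTo f m ⊑ applyUpTo f n
  applyUpTo-⊑ f {m} {n} m≤n =
    applyUpTo (shift m f) (n ∸ m) , trans (sym (applyUpTo-+ f m (n ∸ m))) (cong (applyUpTo f) (ℕₚ.m+[n∸m]≡n m≤n))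

  applyUpTo-comparable : (f : ℕ → A) (m n : ℕ) → Comparable (applyUpTo f m) (applyUpTo f n)
  applyUpTo-comparable f m n with ℕₚ.≤-total m n
  ... | inj₁ m≤n = inj₁ (applyUpTo-⊑ f m≤n)
  ... | inj₂ n≤m = inj₂ (applyUpTo-⊑ f n≤m)

  applyUpTo-++⁻ : (f : ℕ → A) (m : ℕ) {n : ℕ} {xs : List A} →
    applyUpTo f m ++ xs ≡ applyUpTo f n → xs ≡ applyUpTo (shift m f) (length xs)
  applyUpTo-++⁻ f zero {n} e = trans e (cong (applyUpTo f) (sym (trans (cong length e) (Listₚ.length-applyUpTo f n))))
  applyUpTo-++⁻ f (suc m) {suc n} e = applyUpTo-++⁻ (f ∘ suc) m (Listₚ.∷-injectiveʳ e)

Increasing : (ℕ → ℕ) → Set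
Increasing m = ∀ i → m i < m (suc i)

Positive : (ℕ → ℕ) → Set
Positive m = ∀ i → 1 ≤ m i

shift-increasing : ∀ {m} j → Increasing m → Increasing (shift j m)
shift-increasing {m} j m↑ i = subst (λ z → m (j + i) < m z) (sym (ℕₚ.+-suc j i)) (m↑ (j + i))

shift-positive : ∀ {m} j → Positive m → Positive (shift j m)
shift-positive j pos i = pos (j + i)

Increasing⇒mono-< : ∀ {m} → Increasing m → ∀ {i j} → i < j → m i < m j
Increasing⇒mono-< m↑ {i} {suc j} (s≤s i≤j) with ℕₚ.m≤n⇒m<n∨m≡n i≤j
... | inj₁ i<j  = ℕₚ.<-trans (Increasing⇒mono-< m↑ i<j) (m↑ j)
... | inj₂ refl = m↑ i

applyUpTo-≺-shift : ∀ {m} → Increasing m → ∀ k n → applyUpTo m k ≺ applyUpTo (shift k m) n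
applyUpTo-≺-shift {m} m↑ k n = Allₚ.applyUpTo⁺₁ m k (λ i<k → Allₚ.applyUpTo⁺₂ (shift k m) n
  (λ j → Increasing⇒mono-< m↑ (ℕₚ.<-≤-trans i<k (ℕₚ.m≤m+n k j))))

minL-++-applyUpTo : ∀ (m : ℕ → ℕ) {b rest : List ℕ} K → b ≢ [] → b ++ rest ≡ applyUpTo m K → minL b ≡ m 0
minL-++-applyUpTo m {[]}    K       b≢[] _ = ⊥-elim (b≢[] refl)
minL-++-applyUpTo m {_ ∷ _} (suc K) _    e = Listₚ.∷-injectiveˡ e

≺-trans : ∀ {X Y Z} → Y ≢ [] → X ≺ Y → Y ≺ Z → X ≺ Z
≺-trans {Y = []}    Y≢[] _ _ = ⊥-elim (Y≢[] refl)
≺-trans {Y = _ ∷ _} _    p q = All.map (λ x<Y → All.map (ℕₚ.<-trans (All.head x<Y)) (All.head q)) p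

≺-irrefl : ∀ {X} → X ≢ [] → ¬ X ≺ X
≺-irrefl {[]}    X≢[] _ = X≢[] refl
≺-irrefl {x ∷ _} _    p = ℕₚ.<-irrefl refl (All.head (All.head p))

≺-concat⁺ : ∀ {X} Ys → All (X ≺_) Ys → X ≺ concat Ys
≺-concat⁺ Ys p = All.map Allₚ.concat⁺ (All-swap Ys p)

≺-concat⁻ : ∀ {X} Ys → X ≺ concat Ys → All (X ≺_) Ys
≺-concat⁻ []       _ = []
≺-concat⁻ (Y ∷ Ys) p = All.map (Allₚ.++⁻ˡ Y) p ∷ ≺-concat⁻ Ys (All.map (Allₚ.++⁻ʳ Y) p)

∈-concat-≺ : ∀ {X Y Xs Ys} → X ∈ Xs → Y ∈ Ys → concat Xs ≺ concat Ys → X ≺ Y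
∈-concat-≺ {Ys = Ys} X∈ Y∈ p = All.lookup (≺-concat⁻ Ys (All.lookup (Allₚ.concat⁻ p) X∈)) Y∈

Linked⇒AllPairs-≺ : ∀ {Xs} → All (_≢ []) Xs → Linked _≺_ Xs → AllPairs _≺_ Xs
Linked⇒AllPairs-≺ []                 []       = []
Linked⇒AllPairs-≺ (_ ∷ [])           [-]      = [] ∷ []
Linked⇒AllPairs-≺ (_ ∷ Y≢[] ∷ ne) (X≺Y ∷ l) with Y≺ ∷ ap ← Linked⇒AllPairs-≺ (Y≢[] ∷ ne) l =
  (X≺Y ∷ All.map (≺-trans Y≢[] X≺Y) Y≺) ∷ Y≺ ∷ ap

Linked⇒AllPairs-≺-∷ʳ : ∀ {Xs Y} → All (_≢ []) Xs → Linked _≺_ (Xs ∷ʳ Y) → AllPairs _≺_ (Xs ∷ʳ Y)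
Linked⇒AllPairs-≺-∷ʳ {[]}         []               _           = [] ∷ []
Linked⇒AllPairs-≺-∷ʳ {_ ∷ []}     (_ ∷ [])         (X≺Y ∷ _)  = (X≺Y ∷ []) ∷ [] ∷ []
Linked⇒AllPairs-≺-∷ʳ {_ ∷ _ ∷ _}  (_ ∷ X'≢[] ∷ ne) (X≺X' ∷ l)
  with X'≺ ∷ ap ← Linked⇒AllPairs-≺-∷ʳ (X'≢[] ∷ ne) l =
  (X≺X' ∷ All.map (≺-trans X'≢[] X≺X') X'≺) ∷ X'≺ ∷ ap

AllPairs-concat-≺ : ∀ (Xss : List (List (List ℕ))) → All (AllPairs _≺_) Xss →
  AllPairs _≺_ (map concat Xss) → AllPairs _≺_ (concat Xss)
AllPairs-concat-≺ []         _          _          = []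
AllPairs-concat-≺ (Xs ∷ Xss) (apXs ∷ aps) (Xs≺ ∷ ap) =
  AllPairsₚ.++⁺ apXs (AllPairs-concat-≺ Xss aps ap)
    (All.map (≺-concat⁻ (concat Xss))
      (Allₚ.concat⁻ (subst (concat Xs ≺_) (Listₚ.concat-concat Xss) (≺-concat⁺ (map concat Xss) Xs≺))))

IsColl-++⁻ˡ : ∀ Xs {Ys} → IsColl (Xs ++ Ys) → IsColl Xs
IsColl-++⁻ˡ Xs (c , l) = Allₚ.++⁻ˡ Xs c , Linked-++⁻ˡ Xs l

IsColl-++⁻ʳ : ∀ Xs {Ys} → IsColl (Xs ++ Ys) → IsColl Ys
IsColl-++⁻ʳ Xs (c , l) = Allₚ.++⁻ʳ Xs c , Linked-++⁻ʳ Xs l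

IsColl⇒AllPairs : ∀ {Xs} → IsColl Xs → AllPairs _≺_ Xs
IsColl⇒AllPairs (c , l) = Linked⇒AllPairs-≺ (All.map proj₁ c) l

IsColl-++⇒≺ : ∀ Xs {Ys} → IsColl (Xs ++ Ys) → concat Xs ≺ concat Ys
IsColl-++⇒≺ Xs {Ys} c = Allₚ.concat⁺ (All.map (≺-concat⁺ Ys) (split Xs (IsColl⇒AllPairs c)))
  where
  split : ∀ Xs → AllPairs _≺_ (Xs ++ Ys) → All (λ X → All (X ≺_) Ys) Xs
  split []       _          = []
  split (X ∷ Xs) (X≺ ∷ ap) = Allₚ.++⁻ʳ Xs X≺ ∷ split Xs ap

≺-sorted-≡ : ∀ Xs Ys → AllPairs _≺_ Xs → AllPairs _≺_ Ys → All (_≢ []) Xs → All (_≢ []) Ys →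
  (∀ {F} → F ∈ Xs → F ∈ Ys) → (∀ {F} → F ∈ Ys → F ∈ Xs) → Xs ≡ Ys
≺-sorted-≡ []       []       _ _ _ _ _ _ = refl
≺-sorted-≡ []       (Y ∷ Ys) _ _ _ _ _ Ys⊆ with () ← Ys⊆ (here refl)
≺-sorted-≡ (X ∷ Xs) []       _ _ _ _ Xs⊆ _ with () ← Xs⊆ (here refl)
≺-sorted-≡ (X ∷ Xs) (Y ∷ Ys) (X≺ ∷ apX) (Y≺ ∷ apY) (X≢[] ∷ neX) (Y≢[] ∷ neY) Xs⊆ Ys⊆ =
  heads (Xs⊆ (here refl)) (Ys⊆ (here refl))
  where
  heads : X ∈ Y ∷ Ys → Y ∈ X ∷ Xs → X ∷ Xs ≡ Y ∷ Ys
  heads (there X∈) (here Y≡X)  = ⊥-elim (≺-irrefl X≢[] (subst (_≺ X) Y≡X (All.lookup Y≺ X∈)))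
  heads (there X∈) (there Y∈) = ⊥-elim (≺-irrefl X≢[] (≺-trans Y≢[] (All.lookup X≺ Y∈) (All.lookup Y≺ X∈)))
  heads (here refl) _ = cong (X ∷_) (≺-sorted-≡ Xs Ys apX apY neX neY tails⊆ tails⊇)
    where
    tails⊆ : ∀ {F} → F ∈ Xs → F ∈ Ys
    tails⊆ F∈ with Xs⊆ (there F∈)
    ... | here refl = ⊥-elim (≺-irrefl X≢[] (All.lookup X≺ F∈))
    ... | there F∈' = F∈'
    tails⊇ : ∀ {F} → F ∈ Ys → F ∈ Xs
    tails⊇ F∈ with Ys⊆ (there F∈)
    ... | here refl = ⊥-elim (≺-irrefl Y≢[] (All.lookup Y≺ F∈))
    ... | there F∈' = F∈'

≺-chain : {X : ℕ → List ℕ} → (∀ n → X n ≢ []) → (∀ n → X n ≺ X (suc n)) → ∀ {i j} → i < j → X i ≺ X j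
≺-chain ne X≺ {i} {suc j} (s≤s i≤j) with ℕₚ.m≤n⇒m<n∨m≡n i≤j
... | inj₁ i<j  = ≺-trans (ne j) (≺-chain ne X≺ i<j) (X≺ j)
... | inj₂ refl = X≺ i

module _ {D : ℕ → List ℕ} (D-coll : InfColl D) where

  InfColl-≢[] : ∀ n → D n ≢ []
  InfColl-≢[] n = proj₁ (proj₁ D-coll n)

  InfColl-≺ : ∀ {i j} → i < j → D i ≺ D j
  InfColl-≺ = ≺-chain InfColl-≢[] (proj₂ D-coll)

  InfColl-mins-increasing : Increasing (minL ∘ D)
  InfColl-mins-increasing n with D n | D (suc n) | InfColl-≢[] n | InfColl-≢[] (suc n) | proj₂ D-coll n
  ... | []    | _     | ne | _  | _ = ⊥-elim (ne refl)
  ... | _ ∷ _ | []    | _  | ne | _ = ⊥-elim (ne refl)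
  ... | _ ∷ _ | _ ∷ _ | _  | _  | p = All.head (All.head p)

  InfColl-mins-positive : Positive (minL ∘ D)
  InfColl-mins-positive n with D n | InfColl-≢[] n | proj₂ (proj₂ (proj₁ D-coll n))
  ... | []    | ne | _ = ⊥-elim (ne refl)
  ... | _ ∷ _ | _  | p = All.head p

  InfColl-injective : ∀ {i j} → D i ≡ D j → i ≡ j
  InfColl-injective {i} {j} e with ℕₚ.<-cmp i j
  ... | tri< i<j _ _ = ⊥-elim (≺-irrefl (InfColl-≢[] j) (subst (_≺ D j) e (InfColl-≺ i<j)))
  ... | tri≈ _ i≡j _ = i≡j
  ... | tri> _ _ j<i = ⊥-elim (≺-irrefl (InfColl-≢[] i) (subst (_≺ D i) (sym e) (InfColl-≺ j<i)))

  InfColl-applyUpTo : ∀ k → IsColl (applyUpTo D k)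
  InfColl-applyUpTo k =
    Allₚ.applyUpTo⁺₂ D k (proj₁ D-coll) ,
    AllPairs⇒Linked (AllPairsₚ.applyUpTo⁺₁ D k (λ i<j _ → InfColl-≺ i<j))

  InfColl-applyUpTo-≺ : ∀ k n → concat (applyUpTo D k) ≺ concat (applyUpTo (shift k D) n)
  InfColl-applyUpTo-≺ k n = Allₚ.concat⁺ (Allₚ.applyUpTo⁺₁ D k (λ i<k → ≺-concat⁺ (applyUpTo (shift k D) n)
    (Allₚ.applyUpTo⁺₂ (shift k D) n (λ j → InfColl-≺ (ℕₚ.<-≤-trans i<k (ℕₚ.m≤m+n k j))))))

InfColl-shift : ∀ {D} j → InfColl D → InfColl (shift j D)
InfColl-shift {D} j D-coll =
  (λ i → proj₁ D-coll (j + i)) ,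
  (λ i → subst (λ z → D (j + i) ≺ D z) (sym (ℕₚ.+-suc j i)) (proj₂ D-coll (j + i)))

InfColl-downClosed⇒applyUpTo : ∀ {D} → InfColl D → ∀ L → AllPairs _≺_ L →
  (∀ {F} → F ∈ L → ∃ λ k → D k ≡ F) → (∀ {i k} → D k ∈ L → i < k → D i ∈ L) → L ≡ applyUpTo D (length L)
InfColl-downClosed⇒applyUpTo D-coll []      _          _    _    = refl
InfColl-downClosed⇒applyUpTo {D} D-coll (X ∷ L) (X≺ ∷ ap) from-D down with from-D (here refl)
... | zero , D0≡X =
  cong₂ _∷_ (sym D0≡X) (InfColl-downClosed⇒applyUpTo (InfColl-shift 1 D-coll) L ap from-D' down')
  where
  from-D' : ∀ {F} → F ∈ L → ∃ λ k → D (suc k) ≡ F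
  from-D' F∈ with from-D (there F∈)
  ... | zero  , D0≡F = ⊥-elim (≺-irrefl (subst (_≢ []) D0≡X (InfColl-≢[] D-coll 0))
                                        (All.lookup X≺ (subst (_∈ L) (trans (sym D0≡F) D0≡X) F∈)))
  ... | suc k , e    = k , e
  down' : ∀ {i k} → D (suc k) ∈ L → i < k → D (suc i) ∈ L
  down' D∈ i<k with down (there D∈) (s≤s i<k)
  ... | here Di≡X  with () ← InfColl-injective D-coll (trans Di≡X (sym D0≡X))
  ... | there Di∈L = Di∈L
... | suc k , Dk≡X = ⊥-elim (D0∉ (down (subst (_∈ X ∷ L) (sym Dk≡X) (here refl)) (s≤s z≤n)))
  where
  D0∉ : ¬ D 0 ∈ X ∷ L
  D0∉ (here D0≡X)  with () ← InfColl-injective D-coll (trans D0≡X (sym Dk≡X))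
  D0∉ (there D0∈L) = ≺-irrefl (subst (_≢ []) Dk≡X (InfColl-≢[] D-coll (suc k)))
    (≺-trans (InfColl-≢[] D-coll 0) (All.lookup X≺ D0∈L) (subst (D 0 ≺_) Dk≡X (InfColl-≺ D-coll (s≤s z≤n))))

extend : List (List ℕ) → ℕ → ℕ → List ℕ
extend []       M i       = suc (M + i) ∷ []
extend (X ∷ Xs) M zero    = X
extend (X ∷ Xs) M (suc i) = extend Xs M i

extend-InfColl : ∀ {Xs} M → IsColl Xs → All (All (_≤ M)) Xs → InfColl (extend Xs M)
extend-InfColl M (canon , lk) ≤M = extend-canon canon , extend-≺ lk ≤M
  where
  extend-canon : ∀ {Xs} → All Canon Xs → ∀ i → Canon (extend Xs M i)
  extend-canon {[]}    _        i       = (λ ()) , [-] , s≤s z≤n ∷ []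
  extend-canon {_ ∷ _} (c ∷ _)  zero    = c
  extend-canon {_ ∷ _} (_ ∷ cs) (suc i) = extend-canon cs i
  extend-≺ : ∀ {Xs} → Linked _≺_ Xs → All (All (_≤ M)) Xs → ∀ i → extend Xs M i ≺ extend Xs M (suc i)
  extend-≺ {[]}         _        _        i       = (s≤s (ℕₚ.+-monoʳ-< M (ℕₚ.n<1+n i)) ∷ []) ∷ []
  extend-≺ {_ ∷ []}     _        (≤M ∷ _) zero    =
    All.map (λ x≤M → s≤s (ℕₚ.≤-trans x≤M (ℕₚ.m≤m+n M 0)) ∷ []) ≤M
  extend-≺ {_ ∷ _ ∷ _}  (X≺ ∷ _) _        zero    = X≺
  extend-≺ {_ ∷ _}      lk       (_ ∷ ≤M) (suc i) = extend-≺ (Linked.tail lk) ≤M i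

applyUpTo-extend : ∀ Xs M {k} → k ≤ length Xs → applyUpTo (extend Xs M) k ≡ take k Xs
applyUpTo-extend _        M {zero}  _         = refl
applyUpTo-extend (X ∷ Xs) M {suc k} (s≤s k≤) = cong (X ∷_) (applyUpTo-extend Xs M k≤)

applyUpTo-extend-length : ∀ Xs M → applyUpTo (extend Xs M) (length Xs) ≡ Xs
applyUpTo-extend-length Xs M = trans (applyUpTo-extend Xs M ℕₚ.≤-refl) (Listₚ.take-all (length Xs) Xs ℕₚ.≤-refl)

-- Schreier families are thin

module _ (FS : FundSeq) where

  IsA-resp : ∀ {ξ η s} → ξ ≈ₒ η → IsA FS ξ s → IsA FS η s
  IsA-resp e (A-zero z)        = A-zero (≈ₒ-trans (≈ₒ-sym e) z)
  IsA-resp e (A-suc z p d q)   = A-suc (≈ₒ-trans (≈ₒ-sym e) z) p d q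
  IsA-resp e (A-ωsuc {β = β} b bs z d lk len eq) = A-ωsuc {β = β} b bs (≈ₒ-trans (≈ₒ-sym e) z) d lk len eq
  IsA-resp e (A-ωlim {l = l} p z d) = A-ωlim {l = l} p (≈ₒ-trans (≈ₒ-sym e) z) d
  IsA-resp e (A-cnf a b rest lim lo hi z desc pos ne pm d lkb lkr eq) =
    A-cnf a b rest ((λ η≈0 → proj₁ lim (≈ₒ-trans e η≈0)) , (λ ζ η≈ → proj₂ lim ζ (≈ₒ-trans e η≈)))
      (<ₒ-≤ₒ-trans lo (proj₁ e)) (≤ₒ-<ₒ-trans (proj₂ e) hi) (≈ₒ-trans (≈ₒ-sym e) z) desc pos ne pm d lkb lkr eq

  -- The equation s ≡ [] is kept separate so that the recursion below stays structural.
  IsA-[]⇒≈0 : ∀ {ξ s} → IsA FS ξ s → s ≡ [] → ξ ≈ₒ bzero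
  IsA-[]⇒≈0 (A-zero z) _ = z
  IsA-[]⇒≈0 (A-ωsuc {β = β} b bs z (d ∷ _) _ _ refl) e =
    ⊥-elim (ω^≉0 β ≈ₒ-refl (IsA-[]⇒≈0 d (Listₚ.++-conicalˡ b _ e)))
  IsA-[]⇒≈0 (A-cnf a []      rest _ _ _ _ _ _ (b≢[] ∷ _) _ _ _ _ _) _ = ⊥-elim (b≢[] refl)
  IsA-[]⇒≈0 (A-cnf a (b ∷ bs) rest _ _ _ _ _ _ _ _ ((d ∷ _) ∷ _) _ _ refl) e =
    ⊥-elim (ω^≉0 a ≈ₒ-refl (IsA-[]⇒≈0 d (Listₚ.++-conicalˡ b _
      (Listₚ.++-conicalʳ (concat (reverse (map (concat ∘ proj₂) rest))) _
        (trans (sym (concat-reverse-∷ (concat ∘ proj₂) (a , b ∷ bs) rest)) e)))))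

  IsA-≢[] : ∀ {ξ s} → ¬ ξ ≈ₒ bzero → IsA FS ξ s → s ≢ []
  IsA-≢[] ξ≉0 d s≡[] = ξ≉0 (IsA-[]⇒≈0 d s≡[])

module _ (em : ExcludedMiddle 0ℓ) (FS : FundSeq) where
  open FundSeq FS

  Thin : Brw → Set
  Thin ξ = ∀ {s t} → IsA FS ξ s → IsA FS ξ t → Comparable s t → s ≡ t

  private
    BlocksThin : List (List ℕ) → List (List ℕ) → Set
    BlocksThin = Pointwise (λ xs ys → Comparable xs ys → xs ≡ ys)

  module _ {ξ : Brw} (ih : ∀ {η} → η <ₒ ξ → Thin η) where

    thin-ωsuc : ∀ {β β' b b' bs bs'} → ξ ≈ₒ ω^ (bsuc β) → ξ ≈ₒ ω^ (bsuc β') →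
      All (IsA FS (ω^ β)) (b ∷ bs) → All (IsA FS (ω^ β')) (b' ∷ bs') →
      length (b ∷ bs) ≡ minL b → length (b' ∷ bs') ≡ minL b' →
      Comparable (concat (b ∷ bs)) (concat (b' ∷ bs')) → concat (b ∷ bs) ≡ concat (b' ∷ bs')
    thin-ωsuc {β} {β'} {b} {b'} {bs} {bs'} z z' ds ds' len len' c =
      cong concat (concat-comparable⇒≡ (b ∷ bs) (b' ∷ bs') blocks c)
      where
      β'≈β : ω^ β' ≈ₒ ω^ β
      β'≈β = ω^-cong (bsuc-injective (≈ω^-≈ω^⇒≈ em (bsuc β') (bsuc β) z' z))
      mins : minL b ≡ minL b'
      mins = comparable-minL (IsA-≢[] FS (ω^≉0 β ≈ₒ-refl) (All.head ds))
                             (IsA-≢[] FS (ω^≉0 β' ≈ₒ-refl) (All.head ds')) c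
      blocks : BlocksThin (b ∷ bs) (b' ∷ bs')
      blocks = Pointwise-fromAll (λ d d' → ih (<ₒ-≤ₒ-trans (ω^<ₒω^bsuc β) (proj₂ z)) d (IsA-resp FS β'≈β d'))
                                 ds ds' (trans len (trans mins (sym len')))

    thin-cnf : ∀ {a a' b b' rest rest'} → ω^ a <ₒ ξ →
      ξ ≈ₒ cnf ((a , b) ∷ rest) → ξ ≈ₒ cnf ((a' , b') ∷ rest') →
      NF ((a , b) ∷ rest) → NF ((a' , b') ∷ rest') →
      All (λ t → All (IsA FS (ω^ proj₁ t)) (proj₂ t)) ((a , b) ∷ rest) →
      All (λ t → All (IsA FS (ω^ proj₁ t)) (proj₂ t)) ((a' , b') ∷ rest') →
      let P = (a , b) ∷ rest; P' = (a' , b') ∷ rest' in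
      Comparable (concat (reverse (map (concat ∘ proj₂) P))) (concat (reverse (map (concat ∘ proj₂) P'))) →
      concat (reverse (map (concat ∘ proj₂) P)) ≡ concat (reverse (map (concat ∘ proj₂) P'))
    thin-cnf {a} {a'} {b} {b'} {rest} {rest'} lo z z' nf nf' ds ds' c =
      cong (concat ∘ reverse) (trans (Listₚ.map-∘ P) (trans (cong (map concat) blocks≡) (sym (Listₚ.map-∘ P'))))
      where
      P  = (a , b) ∷ rest
      P' = (a' , b') ∷ rest'
      below : All (λ t → ω^ proj₁ t <ₒ ξ) P
      below = All.map (λ e≤a → ≤ₒ-<ₒ-trans (ω^-mono-≤ₒ e≤a) lo) (descending⇒≤ₒhead (proj₁ nf))
      part : ∀ {t t'} → EquivShape t t' → All (IsA FS (ω^ proj₁ t)) (proj₂ t) × ω^ proj₁ t <ₒ ξ →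
             All (IsA FS (ω^ proj₁ t')) (proj₂ t') → BlocksThin (proj₂ t) (proj₂ t')
      part (e≈e' , |b|≡|b'|) (d , lt) d' =
        Pointwise-fromAll (λ x y → ih lt x (IsA-resp FS (ω^-cong (≈ₒ-sym e≈e')) y)) d d' |b|≡|b'|
      blocks≡ : map proj₂ P ≡ map proj₂ P'
      blocks≡ = concat-reverse-comparable⇒≡ proj₂ P P'
        (Pointwise-zipAll part (cnf-injective em P P' nf nf' (≈ₒ-trans (≈ₒ-sym z) z')) (All.zip (ds , below)) ds') c

    thin-ωlim : ∀ {l l' n s t} (lim : IsLimit l) (lim' : IsLimit l') → ξ ≈ₒ ω^ l → ξ ≈ₒ ω^ l' →
      IsA FS (ω^ (fs l lim (n ∸ 1))) (n ∷ s) → IsA FS (ω^ (fs l' lim' (n ∸ 1))) (n ∷ t) →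
      Comparable (n ∷ s) (n ∷ t) → n ∷ s ≡ n ∷ t
    thin-ωlim {l} {l'} {n} lim lim' z z' d d' =
      ih (<ₒ-≤ₒ-trans (ω^-mono-<ₒ (fs-below l lim (n ∸ 1))) (proj₂ z))
         d (IsA-resp FS (ω^-cong (fs-resp lim' lim (≈ω^-≈ω^⇒≈ em l' l z' z) (n ∸ 1))) d')

    thin-step : Thin ξ
    thin-step (A-zero _) (A-zero _) _ = refl
    thin-step (A-zero z) (A-suc z' _ _ _) _ = ⊥-elim (bsuc≉0 (≈ₒ-trans (≈ₒ-sym z') z))
    thin-step (A-zero z) (A-ωsuc {β = β'} _ _ z' _ _ _ _) _ = ⊥-elim (ω^≉0 (bsuc β') z' z)
    thin-step (A-zero z) (A-ωlim {l = l'} _ z' _) _ = ⊥-elim (ω^≉0 l' z' z)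
    thin-step (A-zero z) (A-cnf _ _ _ lim' _ _ _ _ _ _ _ _ _ _ _) _ = ⊥-elim (proj₁ lim' z)
    thin-step (A-suc z _ _ _) (A-zero z') _ = ⊥-elim (bsuc≉0 (≈ₒ-trans (≈ₒ-sym z) z'))
    thin-step (A-suc z _ d _) (A-suc z' _ d' _) c with refl , c' ← comparable-∷⁻ c =
      cong (_ ∷_) (ih (proj₂ z) d (IsA-resp FS (bsuc-injective (≈ₒ-trans (≈ₒ-sym z') z)) d') c')
    thin-step (A-suc z _ _ _) (A-ωsuc {β = β'} _ _ z' _ _ _ _) _ = ⊥-elim (bsuc≉0 (≈bsuc-≈ω^⇒≈0 em (bsuc β') z z'))
    thin-step (A-suc z _ _ _) (A-ωlim {l = l'} lim' z' _) _ = ⊥-elim (proj₁ lim' (≈bsuc-≈ω^⇒≈0 em l' z z'))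
    thin-step (A-suc z _ _ _) (A-cnf _ _ _ lim' _ _ _ _ _ _ _ _ _ _ _) _ = ⊥-elim (proj₂ lim' _ z)
    thin-step (A-ωsuc {β = β} _ _ z _ _ _ _) (A-zero z') _ = ⊥-elim (ω^≉0 (bsuc β) z z')
    thin-step (A-ωsuc {β = β} _ _ z _ _ _ _) (A-suc z' _ _ _) _ = ⊥-elim (bsuc≉0 (≈bsuc-≈ω^⇒≈0 em (bsuc β) z' z))
    thin-step (A-ωsuc {β = β} _ _ z ds _ len refl) (A-ωsuc {β = β'} _ _ z' ds' _ len' refl) c =
      thin-ωsuc {β} {β'} z z' ds ds' len len' c
    thin-step (A-ωsuc {β = β} _ _ z _ _ _ _) (A-ωlim {l = l'} lim' z' _) _ =
      ⊥-elim (proj₂ lim' β (≈ₒ-sym (≈ω^-≈ω^⇒≈ em (bsuc β) l' z z')))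
    thin-step (A-ωsuc {β = β} _ _ z _ _ _ _) (A-cnf a' _ _ _ lo' hi' _ _ _ _ _ _ _ _ _) _ =
      ⊥-elim (ω^-not-between em (bsuc β) a' z lo' hi')
    thin-step (A-ωlim {l = l} _ z _) (A-zero z') _ = ⊥-elim (ω^≉0 l z z')
    thin-step (A-ωlim {l = l} lim z _) (A-suc z' _ _ _) _ = ⊥-elim (proj₁ lim (≈bsuc-≈ω^⇒≈0 em l z' z))
    thin-step (A-ωlim {l = l} lim z _) (A-ωsuc {β = β'} _ _ z' _ _ _ _) _ =
      ⊥-elim (proj₂ lim β' (≈ₒ-sym (≈ω^-≈ω^⇒≈ em (bsuc β') l z' z)))
    thin-step (A-ωlim lim z d) (A-ωlim lim' z' d') c with refl , _ ← comparable-∷⁻ c = thin-ωlim lim lim' z z' d d' c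
    thin-step (A-ωlim {l = l} _ z _) (A-cnf a' _ _ _ lo' hi' _ _ _ _ _ _ _ _ _) _ = ⊥-elim (ω^-not-between em l a' z lo' hi')
    thin-step (A-cnf _ _ _ lim _ _ _ _ _ _ _ _ _ _ _) (A-zero z') _ = ⊥-elim (proj₁ lim z')
    thin-step (A-cnf _ _ _ lim _ _ _ _ _ _ _ _ _ _ _) (A-suc z' _ _ _) _ = ⊥-elim (proj₂ lim _ z')
    thin-step (A-cnf a _ _ _ lo hi _ _ _ _ _ _ _ _ _) (A-ωsuc {β = β'} _ _ z' _ _ _ _) _ =
      ⊥-elim (ω^-not-between em (bsuc β') a z' lo hi)
    thin-step (A-cnf a _ _ _ lo hi _ _ _ _ _ _ _ _ _) (A-ωlim {l = l'} _ z' _) _ = ⊥-elim (ω^-not-between em l' a z' lo hi)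
    thin-step (A-cnf _ _ _ _ lo _ z desc _ ne _ ds _ _ refl) (A-cnf _ _ _ _ _ _ z' desc' _ ne' _ ds' _ _ refl) c =
      thin-cnf lo z z' (desc , ne) (desc' , ne') ds ds' c

  IsA-thin : ∀ ξ → Thin ξ
  IsA-thin = <ₒ-rec Thin (λ _ → thin-step)

-- Every increasing sequence has an initial segment in a Schreier family

module _ (em : ExcludedMiddle 0ℓ) (FS : FundSeq) where
  open FundSeq FS

  HasInitialSegments : Brw → Set
  HasInitialSegments ξ = ∀ m → Increasing m → Positive m → ∃ λ k → IsA FS ξ (applyUpTo m k)

  Blocks : Brw → ℕ → (ℕ → ℕ) → List (List ℕ) → Set
  Blocks X c m bs = length bs ≡ c × All (IsA FS X) bs × Linked _≺_ bs × ∃ λ K → concat bs ≡ applyUpTo m K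

  consecutive-blocks : ∀ {X} → HasInitialSegments X → ∀ c m → Increasing m → Positive m → ∃ (Blocks X c m)
  consecutive-blocks seg zero    m m↑ m⁺ = [] , refl , [] , [] , 0 , refl
  consecutive-blocks seg (suc c) m m↑ m⁺ with k , d ← seg m m↑ m⁺
    with bs , |bs| , ds , lk , K , eq ← consecutive-blocks seg c (shift k m) (shift-increasing k m↑) (shift-positive k m⁺) =
    applyUpTo m k ∷ bs , cong suc |bs| , d ∷ ds ,
    Linked-∷⁺ (≺-concat⁻ bs (subst (applyUpTo m k ≺_) (sym eq) (applyUpTo-≺-shift m↑ k K))) lk ,
    k + K , trans (cong (applyUpTo m k ++_) eq) (sym (applyUpTo-+ m k K))

  Filling : (ℕ → ℕ) → List Part → List Part → Set
  Filling m P Q = Pointwise SameShape P Q ×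
    All (λ t → All (IsA FS (ω^ proj₁ t)) (proj₂ t)) Q × All (λ t → Linked _≺_ (proj₂ t)) Q ×
    Linked _≺_ (reverse (map (concat ∘ proj₂) Q)) × ∃ λ K → concat (reverse (map (concat ∘ proj₂) Q)) ≡ applyUpTo m K

  fill : ∀ P → All (λ t → HasInitialSegments (ω^ proj₁ t)) P → ∀ m → Increasing m → Positive m → ∃ (Filling m P)
  fill []            _            m _  _  = [] , [] , [] , [] , [] , 0 , refl
  fill ((e , b) ∷ P) (seg ∷ segs) m m↑ m⁺ with fill P segs m m↑ m⁺
  ... | Q , shapes , ds , lks , lk , K₁ , eq₁
    with bs , |bs| , ds' , lk' , K₂ , eq₂ ←
         consecutive-blocks seg (length b) (shift K₁ m) (shift-increasing K₁ m↑) (shift-positive K₁ m⁺) =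
    (e , bs) ∷ Q , (refl , sym |bs|) ∷ shapes , ds' ∷ ds , lk' ∷ lks , lk-∷ , K₁ + K₂ ,
    trans (concat-reverse-∷ (concat ∘ proj₂) (e , bs) Q) (trans (cong₂ _++_ eq₁ eq₂) (sym (applyUpTo-+ m K₁ K₂)))
    where
    earlier≺ : All (_≺ concat bs) (reverse (map (concat ∘ proj₂) Q))
    earlier≺ = Allₚ.concat⁻ (subst₂ _≺_ (sym eq₁) (sym eq₂) (applyUpTo-≺-shift m↑ K₁ K₂))
    lk-∷ : Linked _≺_ (reverse (map (concat ∘ proj₂) ((e , bs) ∷ Q)))
    lk-∷ = subst (Linked _≺_) (sym (Listₚ.unfold-reverse (concat bs) (map (concat ∘ proj₂) Q))) (Linked-∷ʳ⁺ lk earlier≺)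

  module _ {ξ : Brw} (ih : ∀ {η} → η <ₒ ξ → HasInitialSegments η)
           (m : ℕ → ℕ) (m↑ : Increasing m) (m⁺ : Positive m) (ns : NotSucc ξ) where

    segment-ωsuc : ∀ β → ξ ≈ₒ ω^ (bsuc β) → ∃ λ k → IsA FS ξ (applyUpTo m k)
    segment-ωsuc β ξ≈ with consecutive-blocks (ih (<ₒ-≤ₒ-trans (ω^<ₒω^bsuc β) (proj₂ ξ≈))) (m 0) m m↑ m⁺
    ... | [] , |bs| , _ = ⊥-elim (ℕₚ.1+n≰n (subst (1 ≤_) (sym |bs|) (m⁺ 0)))
    ... | b ∷ bs , |bs| , ds , lk , K , eq =
      K , A-ωsuc {β = β} b bs ξ≈ ds lk
            (trans |bs| (sym (minL-++-applyUpTo m K (IsA-≢[] FS (ω^≉0 β ≈ₒ-refl) (All.head ds)) eq))) (sym eq)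

    segment-ωlim : ∀ l (lim : IsLimit l) → ξ ≈ₒ ω^ l → ∃ λ k → IsA FS ξ (applyUpTo m k)
    segment-ωlim l lim ξ≈ with ih (<ₒ-≤ₒ-trans (ω^-mono-<ₒ (fs-below l lim (m 0 ∸ 1))) (proj₂ ξ≈)) m m↑ m⁺
    ... | zero  , d = ⊥-elim (ω^≉0 (fs l lim (m 0 ∸ 1)) ≈ₒ-refl (IsA-[]⇒≈0 FS d refl))
    ... | suc k , d = suc k , A-ωlim lim ξ≈ d

    segment-power : ∀ a → ξ ≈ₒ ω^ a → ∃ λ k → IsA FS ξ (applyUpTo m k)
    segment-power a ξ≈ with em {a ≈ₒ bzero} | em {∃ λ β → a ≈ₒ bsuc β}
    ... | yes a≈0 | _            = ⊥-elim (ns bzero (≈ₒ-trans ξ≈ (ω^-cong a≈0)))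
    ... | no _    | yes (β , a≈) = segment-ωsuc β (≈ₒ-trans ξ≈ (ω^-cong a≈))
    ... | no a≉0  | no ¬succ     = segment-ωlim a (a≉0 , λ ζ a≈ → ¬succ (ζ , a≈)) ξ≈

    segment-cnf : ∀ a b rest → ¬ ξ ≈ₒ bzero →
      NF ((a , b) ∷ rest) → All (λ t → bzero <ₒ proj₁ t) ((a , b) ∷ rest) →
      ξ ≈ₒ cnf ((a , b) ∷ rest) → 1 < length b ⊎ rest ≢ [] → ∃ λ k → IsA FS ξ (applyUpTo m k)
    segment-cnf a b rest ξ≉0 nf pos ξ≈ impure = from-filling (fill ((a , b) ∷ rest) segments m m↑ m⁺)
      where
      lo : ω^ a <ₒ ξ
      lo = <ₒ-≤ₒ-trans (ω^<ₒcnf nf impure) (proj₂ ξ≈)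
      segments : All (λ t → HasInitialSegments (ω^ proj₁ t)) ((a , b) ∷ rest)
      segments = All.map (λ e≤a → ih (≤ₒ-<ₒ-trans (ω^-mono-≤ₒ e≤a) lo)) (descending⇒≤ₒhead (proj₁ nf))
      nonempty : ∀ {P Q} → Pointwise SameShape P Q → P ≢ [] → Q ≢ []
      nonempty []      P≢[] = P≢[]
      nonempty (_ ∷ _) _    ()
      from-filling : ∃ (Filling m ((a , b) ∷ rest)) → ∃ λ k → IsA FS ξ (applyUpTo m k)
      from-filling ((_ , b') ∷ rest' , shapes@((refl , |b|≡|b'|) ∷ shapes') , ds , lks , lk , K , eq) =
        K , A-cnf a b' rest' (ξ≉0 , ns) lo (≤ₒ-<ₒ-trans (proj₁ ξ≈) (cnf<ₒω^bsuc nf))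
                  (≈ₒ-trans ξ≈ (≡⇒≈ₒ (cnf-sameShape shapes)))
                  (descending-sameShape shapes (proj₁ nf)) (positive-sameShape shapes' (All.tail pos))
                  (nonempty-sameShape shapes (proj₂ nf)) impure' ds lks lk (sym eq)
        where
        impure' : 1 < length b' ⊎ rest' ≢ []
        impure' = Sum.map (subst (1 <_) |b|≡|b'|) (nonempty shapes') impure

    segment-limit : ¬ ξ ≈ₒ bzero → HasCNF ξ → ∃ λ k → IsA FS ξ (applyUpTo m k)
    segment-limit ξ≉0 ([] , _ , _ , ξ≈0) = ⊥-elim (ξ≉0 ξ≈0)
    segment-limit ξ≉0 ((a , []) ∷ [] , (_ , b≢[] ∷ _) , _ , _) = ⊥-elim (b≢[] refl)
    segment-limit ξ≉0 ((a , _ ∷ []) ∷ [] , _ , _ , ξ≈) = segment-power a (≈ₒ-trans ξ≈ (*ₒ-identityʳ (ω^ a)))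
    segment-limit ξ≉0 ((a , b@(_ ∷ _ ∷ _)) ∷ [] , nf , pos , ξ≈) =
      segment-cnf a b [] ξ≉0 nf pos ξ≈ (inj₁ (s≤s (s≤s z≤n)))
    segment-limit ξ≉0 ((a , b) ∷ rest@(_ ∷ _) , nf , pos , ξ≈) = segment-cnf a b rest ξ≉0 nf pos ξ≈ (inj₂ λ ())

  segment-step : ∀ ξ → (∀ {η} → η <ₒ ξ → HasInitialSegments η) → HasInitialSegments ξ
  segment-step ξ ih m m↑ m⁺ with em {ξ ≈ₒ bzero} | em {∃ λ ζ → ξ ≈ₒ bsuc ζ}
  ... | yes ξ≈0 | _ = 0 , A-zero ξ≈0
  ... | no _    | yes (ζ , ξ≈) with k , d ← ih (proj₂ ξ≈) (shift 1 m) (shift-increasing 1 m↑) (shift-positive 1 m⁺) =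
    suc k , A-suc ξ≈ (m⁺ 0) d (Allₚ.applyUpTo⁺₂ (shift 1 m) k (λ i → Increasing⇒mono-< m↑ (s≤s z≤n)) ∷ [])
  ... | no ξ≉0  | no ¬succ = segment-limit ih m m↑ m⁺ ns ξ≉0 (cnf-exists em ξ ns)
    where
    ns : NotSucc ξ
    ns ζ ξ≈ = ¬succ (ζ , ξ≈)

  IsA-initialSegment : ∀ ξ → HasInitialSegments ξ
  IsA-initialSegment = <ₒ-rec HasInitialSegments segment-step

-- Decompositions into Schreier blocks

module _ (em : ExcludedMiddle 0ℓ) (FS : FundSeq) (ξ : Brw) (ξ≉0 : ¬ ξ ≈ₒ bzero) where

  Bξ : List (List ℕ) → Set
  Bξ = B FS ξ

  B-≢[] : ∀ {X} → Bξ X → X ≢ []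
  B-≢[] = proj₁ ∘ proj₂

  B-concat-≢[] : ∀ {X} → Bξ X → concat X ≢ []
  B-concat-≢[] {[]}    bX = ⊥-elim (B-≢[] bX refl)
  B-concat-≢[] {Y ∷ X} bX e = proj₁ (All.head (proj₁ (proj₁ bX))) (Listₚ.++-conicalˡ Y _ e)

  B-thin : ∀ {X Y} → Bξ X → Bξ Y → Comparable X Y → X ≡ Y
  B-thin {X} {Y} bX bY c = comparable-length⇒≡ c
    (trans (sym (Listₚ.length-map minL X))
      (trans (cong length (IsA-thin em FS ξ (proj₂ (proj₂ bX)) (proj₂ (proj₂ bY)) (comparable-map minL c)))
             (Listₚ.length-map minL Y)))

  Star-IsColl : ∀ {X} → Star FS Bξ X → IsColl X
  Star-IsColl (inj₁ refl)                = [] , []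
  Star-IsColl {X} (inj₂ (_ , bY , _ , refl)) = IsColl-++⁻ˡ X (proj₁ bY)

  Star-¬B⇒¬B⊑ : ∀ {X Y} → Star FS Bξ X → ¬ Bξ X → Bξ Y → ¬ Y ⊑ X
  Star-¬B⇒¬B⊑ (inj₁ refl) _ bY (Z , e) = B-≢[] bY (Listₚ.++-conicalˡ _ Z e)
  Star-¬B⇒¬B⊑ {X} {Y} (inj₂ (W , bW , V , X++V≡W)) ¬bX bY (Z , Y++Z≡X) = ¬bX (subst Bξ (sym X≡Y) bY)
    where
    Y++Z++V≡W : Y ++ (Z ++ V) ≡ W
    Y++Z++V≡W = trans (sym (Listₚ.++-assoc Y Z V)) (trans (cong (_++ V) Y++Z≡X) X++V≡W)
    Y≡W : Y ≡ W
    Y≡W = B-thin bY bW (inj₁ (Z ++ V , Y++Z++V≡W))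
    Z≡[] : Z ≡ []
    Z≡[] = Listₚ.++-conicalˡ Z V (Listₚ.++-cancelˡ Y _ _ (trans Y++Z++V≡W (trans (sym Y≡W) (sym (Listₚ.++-identityʳ Y)))))
    X≡Y : X ≡ Y
    X≡Y = trans (sym Y++Z≡X) (trans (cong (Y ++_) Z≡[]) (Listₚ.++-identityʳ Y))

  Decomposition : List (List ℕ) → List (List (List ℕ)) × List (List ℕ) → Set
  Decomposition s (ss , last) =
    All Bξ ss × Star FS Bξ last × ¬ Bξ last × Linked _≺_ (map concat (ss ∷ʳ last)) × concat ss ++ last ≡ s

  concat-decomposition-injective : ∀ ss last ss' last' →
    All Bξ ss → Star FS Bξ last → ¬ Bξ last → All Bξ ss' → Star FS Bξ last' → ¬ Bξ last' →
    concat ss ++ last ≡ concat ss' ++ last' → (ss , last) ≡ (ss' , last')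
  concat-decomposition-injective [] last [] last' _ _ _ _ _ _ e = cong ([] ,_) e
  concat-decomposition-injective [] last (Y ∷ ss') last' _ st ¬b (bY ∷ _) _ _ e =
    ⊥-elim (Star-¬B⇒¬B⊑ st ¬b bY (concat ss' ++ last' , trans (sym (Listₚ.++-assoc Y (concat ss') last')) (sym e)))
  concat-decomposition-injective (X ∷ ss) last [] last' (bX ∷ _) _ _ _ st' ¬b' e =
    ⊥-elim (Star-¬B⇒¬B⊑ st' ¬b' bX (concat ss ++ last , trans (sym (Listₚ.++-assoc X (concat ss) last)) e))
  concat-decomposition-injective (X ∷ ss) last (Y ∷ ss') last' (bX ∷ bss) st ¬b (bY ∷ bss') st' ¬b' e =
    cong₂ (λ Z r → Z ∷ proj₁ r , proj₂ r) X≡Y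
      (concat-decomposition-injective ss last ss' last' bss st ¬b bss' st' ¬b'
        (Listₚ.++-cancelˡ X _ _ (trans e' (cong (_++ (concat ss' ++ last')) (sym X≡Y)))))
    where
    e' : X ++ (concat ss ++ last) ≡ Y ++ (concat ss' ++ last')
    e' = trans (sym (Listₚ.++-assoc X (concat ss) last)) (trans e (Listₚ.++-assoc Y (concat ss') last'))
    X≡Y : X ≡ Y
    X≡Y = B-thin bX bY (++≡++⇒comparable X Y e')

  first-block : ∀ {D} → InfColl D → ∃ λ k → Bξ (applyUpTo D (suc k))
  first-block {D} D-coll
    with IsA-initialSegment em FS ξ (minL ∘ D) (InfColl-mins-increasing D-coll) (InfColl-mins-positive D-coll)
  ... | zero  , d = ⊥-elim (ξ≉0 (IsA-[]⇒≈0 FS d refl))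
  ... | suc k , d = k , InfColl-applyUpTo D-coll (suc k) , (λ ()) ,
                    subst (IsA FS ξ) (sym (Listₚ.map-applyUpTo D minL (suc k))) d

  Decomposition-++ : ∀ {X ys ss last} → Bξ X → IsColl (X ++ ys) → Decomposition ys (ss , last) →
    Decomposition (X ++ ys) (X ∷ ss , last)
  Decomposition-++ {X} {ys} {ss} {last} bX coll (bss , st , ¬b , lk , eq) =
    bX ∷ bss , st , ¬b , Linked-∷⁺ X≺ lk , trans (Listₚ.++-assoc X (concat ss) last) (cong (X ++_) eq)
    where
    concat≡ : concat ys ≡ concat (map concat (ss ∷ʳ last))
    concat≡ = sym (trans (Listₚ.concat-concat (ss ∷ʳ last)) (cong concat (trans (concat-∷ʳ ss last) eq)))
    X≺ : All (concat X ≺_) (map concat (ss ∷ʳ last))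
    X≺ = ≺-concat⁻ (map concat (ss ∷ʳ last)) (subst (concat X ≺_) concat≡ (IsColl-++⇒≺ X coll))

  greedy : ∀ n s → length s ≤ n → IsColl s → ∃ (Decomposition s)
  greedy _       []        _           _      = ([] , []) , [] , inj₁ refl , (λ b → B-≢[] b refl) , [-] , refl
  greedy (suc n) s@(_ ∷ _) (s≤s |s|≤n) s-coll = split (first-block D-coll)
    where
    M = max 0 (concat s)
    D = extend s M
    D-coll : InfColl D
    D-coll = extend-InfColl M s-coll (Allₚ.concat⁻ (xs≤max 0 (concat s)))
    split : ∃ (λ k → Bξ (applyUpTo D (suc k))) → ∃ (Decomposition s)
    split (k , bD) with suc k ≤? length s
    ... | yes k<|s| = let (ss , last) , dec = greedy n rest |rest|≤n (IsColl-++⁻ʳ X coll)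
                      in (X ∷ ss , last) , subst (λ z → Decomposition z (X ∷ ss , last)) X++rest≡s
                                                 (Decomposition-++ bX coll dec)
      where
      X    = take (suc k) s
      rest = drop (suc k) s
      X++rest≡s : X ++ rest ≡ s
      X++rest≡s = Listₚ.take++drop≡id (suc k) s
      coll : IsColl (X ++ rest)
      coll = subst IsColl (sym X++rest≡s) s-coll
      bX : Bξ X
      bX = subst Bξ (applyUpTo-extend s M k<|s|) bD
      |rest|≤n : length rest ≤ n
      |rest|≤n = subst (_≤ n) (sym (Listₚ.length-drop (suc k) s)) (ℕₚ.≤-trans (ℕₚ.m∸n≤m _ k) |s|≤n)
    ... | no  k≮|s| = ([] , s) , [] , inj₂ (applyUpTo D (suc k) , bD , s⊑D) , ¬bs , [-] , refl
      where
      s⊑D : s ⊑ applyUpTo D (suc k)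
      s⊑D = subst (_⊑ applyUpTo D (suc k)) (applyUpTo-extend-length s M)
                  (applyUpTo-⊑ D (ℕₚ.<⇒≤ (ℕₚ.≰⇒> k≮|s|)))
      ¬bs : ¬ Bξ s
      ¬bs bs = k≮|s| (ℕₚ.≤-reflexive (sym (trans (cong length (B-thin bs bD (inj₁ s⊑D)))
                                                 (Listₚ.length-applyUpTo D (suc k)))))

  FinDecomp⇒Decomposition : ∀ {s ss last} → IsColl s → FinDecomp FS ξ s (ss , last) → Decomposition s (ss , last)
  FinDecomp⇒Decomposition {s} {ss} {last} s-coll (bss , st , ¬b , lk , mem) =
    bss , st , ¬b , lk ,
    ≺-sorted-≡ (concat ss ++ last) s sorted (IsColl⇒AllPairs s-coll) nonempty (All.map proj₁ (proj₁ s-coll)) ⊆s s⊆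
    where
    blocks-sorted : All (AllPairs _≺_) (ss ∷ʳ last)
    blocks-sorted = Allₚ.++⁺ (All.map (IsColl⇒AllPairs ∘ proj₁) bss) (IsColl⇒AllPairs (Star-IsColl st) ∷ [])
    concats-sorted : AllPairs _≺_ (map concat (ss ∷ʳ last))
    concats-sorted = subst (AllPairs _≺_) (sym (Listₚ.map-++ concat ss (last ∷ [])))
      (Linked⇒AllPairs-≺-∷ʳ (Allₚ.map⁺ (All.map B-concat-≢[] bss))
        (subst (Linked _≺_) (Listₚ.map-++ concat ss (last ∷ [])) lk))
    sorted : AllPairs _≺_ (concat ss ++ last)
    sorted = subst (AllPairs _≺_) (concat-∷ʳ ss last) (AllPairs-concat-≺ (ss ∷ʳ last) blocks-sorted concats-sorted)
    nonempty : All (_≢ []) (concat ss ++ last)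
    nonempty = Allₚ.++⁺ (Allₚ.concat⁺ (All.map (All.map proj₁ ∘ proj₁ ∘ proj₁) bss))
                        (All.map proj₁ (proj₁ (Star-IsColl st)))
    ⊆s : ∀ {F} → F ∈ concat ss ++ last → F ∈ s
    ⊆s = proj₂ (mem _) ∘ ∈-concat-++⁻ ss
    s⊆ : ∀ {F} → F ∈ s → F ∈ concat ss ++ last
    s⊆ = ∈-concat-++⁺ ss ∘ proj₁ (mem _)

  Decomposition⇒FinDecomp : ∀ {s ss last} → Decomposition s (ss , last) → FinDecomp FS ξ s (ss , last)
  Decomposition⇒FinDecomp {ss = ss} (bss , st , ¬b , lk , refl) =
    bss , st , ¬b , lk , λ F → ∈-concat-++⁻ ss , ∈-concat-++⁺ ss

  finite-decomposition : ∀ s → IsColl s →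
    ∃ λ r → FinDecomp FS ξ s r × (∀ r' → FinDecomp FS ξ s r' → r ≡ r')
  finite-decomposition s s-coll with (ss , last) , dec ← greedy (length s) s ℕₚ.≤-refl s-coll =
    (ss , last) , Decomposition⇒FinDecomp dec , unique
    where
    unique : ∀ r' → FinDecomp FS ξ s r' → (ss , last) ≡ r'
    unique (ss' , last') fd' with bss' , st' , ¬b' , _ , eq' ← FinDecomp⇒Decomposition s-coll fd' =
      let bss , st , ¬b , _ , eq = dec in
      concat-decomposition-injective ss last ss' last' bss st ¬b bss' st' ¬b' (trans eq (sym eq'))

  module _ {D : ℕ → List ℕ} (D-coll : InfColl D) where

    block-length : ℕ → ℕ
    block-length j = suc (proj₁ (first-block (InfColl-shift j D-coll)))

    block-start : ℕ → ℕ
    block-start zero    = 0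
    block-start (suc n) = block-start n + block-length (block-start n)

    block : ℕ → List (List ℕ)
    block n = applyUpTo (shift (block-start n) D) (block-length (block-start n))

    block-B : ∀ n → Bξ (block n)
    block-B n = proj₂ (first-block (InfColl-shift (block-start n) D-coll))

    block-≺ : ∀ n → concat (block n) ≺ concat (block (suc n))
    block-≺ n = subst (λ z → concat (block n) ≺ concat z)
      (sym (applyUpTo-cong (λ i → cong D (ℕₚ.+-assoc (block-start n) L i)) L'))
      (InfColl-applyUpTo-≺ (InfColl-shift (block-start n) D-coll) L L')
      where
      L  = block-length (block-start n)
      L' = block-length (block-start (suc n))

    locate : ∀ k → ∃ λ n → block-start n ≤ k × k < block-start (suc n)
    locate zero = 0 , z≤n , s≤s z≤n
    locate (suc k) with n , start≤k , k<end ← locate k with suc k <? block-start (suc n)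
    ... | yes k<end' = n , ℕₚ.m≤n⇒m≤1+n start≤k , k<end'
    ... | no  k≮end' = suc n , ℕₚ.≤-reflexive (sym k+1≡end) ,
                       subst (_< block-start (suc (suc n))) (sym k+1≡end) (ℕₚ.m<m+n (block-start (suc n)) (s≤s z≤n))
      where
      k+1≡end : suc k ≡ block-start (suc n)
      k+1≡end = ℕₚ.≤-antisym k<end (ℕₚ.≮⇒≥ k≮end')

    ∈-block⁺ : ∀ k → ∃ λ n → D k ∈ block n
    ∈-block⁺ k with n , start≤k , k<end ← locate k =
      n , subst (_∈ block n) (cong D (ℕₚ.m+[n∸m]≡n start≤k))
                (∈-applyUpTo⁺ (shift (block-start n) D)
                   (ℕₚ.+-cancelˡ-< (block-start n) _ _
                      (subst (_< block-start (suc n)) (sym (ℕₚ.m+[n∸m]≡n start≤k)) k<end)))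

    ∈-block⁻ : ∀ {F n} → F ∈ block n → ∃ λ k → D k ≡ F
    ∈-block⁻ {n = n} F∈ with i , _ , F≡ ← ∈-applyUpTo⁻ (shift (block-start n) D) F∈ = block-start n + i , sym F≡

    block-decomposition : SeqDecomp FS ξ D block
    block-decomposition =
      block-B , block-≺ , λ F → (λ { (k , refl) → ∈-block⁺ k }) , (λ (n , F∈) → ∈-block⁻ {n = n} F∈)

    module _ {S : ℕ → List (List ℕ)} (S-dec : SeqDecomp FS ξ D S) where

      S-B : ∀ n → Bξ (S n)
      S-B = proj₁ S-dec

      S-≺ : ∀ {i j} → i < j → concat (S i) ≺ concat (S j)
      S-≺ = ≺-chain (B-concat-≢[] ∘ S-B) (proj₁ (proj₂ S-dec))

      S-∈⁺ : ∀ k → ∃ λ n → D k ∈ S n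
      S-∈⁺ k = proj₁ (proj₂ (proj₂ S-dec) (D k)) (k , refl)

      S-∈⁻ : ∀ {F n} → F ∈ S n → ∃ λ k → D k ≡ F
      S-∈⁻ {F} {n} F∈ = proj₂ (proj₂ (proj₂ S-dec) F) (n , F∈)

      prefix : ℕ → List (List ℕ)
      prefix N = concat (applyUpTo S N)

      prefix-initial : ∀ N → prefix N ≡ applyUpTo D (length (prefix N))
      prefix-initial N = InfColl-downClosed⇒applyUpTo D-coll (prefix N) sorted from-D down
        where
        sorted : AllPairs _≺_ (prefix N)
        sorted = AllPairs-concat-≺ (applyUpTo S N) (Allₚ.applyUpTo⁺₂ S N (IsColl⇒AllPairs ∘ proj₁ ∘ S-B))
          (subst (AllPairs _≺_) (sym (Listₚ.map-applyUpTo S concat N))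
                 (AllPairsₚ.applyUpTo⁺₁ (concat ∘ S) N (λ i<j _ → S-≺ i<j)))
        from-D : ∀ {F} → F ∈ prefix N → ∃ λ k → D k ≡ F
        from-D F∈ with i , _ , F∈Si ← Anyₚ.applyUpTo⁻ S (∈-concat⁻ (applyUpTo S N) F∈) = S-∈⁻ F∈Si
        down : ∀ {i k} → D k ∈ prefix N → i < k → D i ∈ prefix N
        down {i} Dk∈ i<k
          with n , n<N , Dk∈Sn ← Anyₚ.applyUpTo⁻ S (∈-concat⁻ (applyUpTo S N) Dk∈)
          with j , Di∈Sj ← S-∈⁺ i
          with j <? N
        ... | yes j<N = ∈-concat⁺ (Anyₚ.applyUpTo⁺ S Di∈Sj j<N)
        ... | no  j≮N = ⊥-elim (≺-irrefl (InfColl-≢[] D-coll i) (≺-trans (InfColl-≢[] D-coll _) (InfColl-≺ D-coll i<k)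
                          (∈-concat-≺ Dk∈Sn Di∈Sj (S-≺ (ℕₚ.<-≤-trans n<N (ℕₚ.≮⇒≥ j≮N))))))

      prefix-step : ∀ n → prefix n ≡ applyUpTo D (block-start n) →
        S n ≡ block n × prefix (suc n) ≡ applyUpTo D (block-start (suc n))
      prefix-step n prefix≡ = Sn≡ , trans prefix-suc (trans (cong (applyUpTo D (block-start n) ++_) Sn≡)
                                                    (sym (applyUpTo-+ D (block-start n) (block-length (block-start n)))))
        where
        prefix-suc : prefix (suc n) ≡ applyUpTo D (block-start n) ++ S n
        prefix-suc = trans (cong concat (sym (Listₚ.applyUpTo-∷ʳ S n)))
                           (trans (concat-∷ʳ (applyUpTo S n) (S n)) (cong (_++ S n) prefix≡))
        suffix : S n ≡ applyUpTo (shift (block-start n) D) (length (S n))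
        suffix = applyUpTo-++⁻ D (block-start n) (trans (sym prefix-suc) (prefix-initial (suc n)))
        Sn≡ : S n ≡ block n
        Sn≡ = B-thin (S-B n) (block-B n) (subst (λ z → Comparable z (block n)) (sym suffix)
                (applyUpTo-comparable (shift (block-start n) D) (length (S n)) (block-length (block-start n))))

      prefix≡ : ∀ n → prefix n ≡ applyUpTo D (block-start n)
      prefix≡ zero    = refl
      prefix≡ (suc n) = proj₂ (prefix-step n (prefix≡ n))

      block-unique : ∀ n → block n ≡ S n
      block-unique n = sym (proj₁ (prefix-step n (prefix≡ n)))

  infinite-decomposition : ∀ D → InfColl D →
    ∃ λ S → SeqDecomp FS ξ D S × (∀ S' → SeqDecomp FS ξ D S' → ∀ n → S n ≡ S' n)
  infinite-decomposition D D-coll = block D-coll , block-decomposition D-coll , λ _ → block-unique D-coll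

proposition2p4 : ((P : Set) → Dec P) → (FS : FundSeq) → (ξ : Brw) → ¬ (ξ ≈ₒ bzero) →
    ((D : ℕ → List ℕ) → InfColl D →
      Σ (ℕ → List (List ℕ)) (λ S → SeqDecomp FS ξ D S
        × ((S' : ℕ → List (List ℕ)) → SeqDecomp FS ξ D S' → (n : ℕ) → S n ≡ S' n)))
    × ((s : List (List ℕ)) → IsColl s → s ≢ [] →
      Σ (List (List (List ℕ)) × List (List ℕ)) (λ r → FinDecomp FS ξ s r
        × ((r' : List (List (List ℕ)) × List (List ℕ)) → FinDecomp FS ξ s r' → r ≡ r')))
proposition2p4 dec FS ξ ξ≉0 =
  infinite-decomposition em FS ξ ξ≉0 , λ s s-coll _ → finite-decomposition em FS ξ ξ≉0 s s-coll
  where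
  em : ExcludedMiddle 0ℓ
  em {P} = dec P
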